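{- Let $n,m\ge1$, $R\le D_4$, and $T$ a set of tile designs for $R$. For $g\in R$ let $\mathrm{Fix}^{\mathrm{tor}}_{g}(n,m)=\sum_{(a,b)\in\mathbb{Z}/n\mathbb{Z}\times\mathbb{Z}/m\mathbb{Z}}|X^{((a,b),g)}|$, where $X^{((a,b),g)}$ is the set of tilings of the $n\times m$ torus fixed by $((a,b),g)$. If $f\in R$, then $$\mathrm{Fix}^{\mathrm{tor}}_{f}(n,m)=n\sum_{c\mid m}\varphi(c)\left(\tfrac12 t_{\mathrm{id}}^{nm/\mathrm{lcm}(2,c)}+\tfrac12 t_{\mathrm{id}}^{(n-2)m/\mathrm{lcm}(2,c)}t_{f^c}^{2m/c}\right)\ \text{ if } n \text{ even},\qquad \mathrm{Fix}^{\mathrm{tor}}_{f}(n,m)=n\sum_{c\mid m}\varphi(c)\,t_{\mathrm{id}}^{(n-1)m/\mathrm{lcm}(2,c)}t_{f^c}^{m/c}\ \text{ if } n \text{ odd}.$$ If $r^2f\in R$, then $$\mathrm{Fix}^{\mathrm{tor}}_{r^2f}(n,m)=m\sum_{d\mid n}\varphi(d)\left(\tfrac12 t_{\mathrm{id}}^{nm/\mathrm{lcm}(d,2)}+\tfrac12 t_{\mathrm{id}}^{n(m-2)/\mathrm{lcm}(d,2)}t_{(r^2f)^d}^{2n/d}\right)\ \text{ if } m \text{ even},\qquad \mathrm{Fix}^{\mathrm{tor}}_{r^2f}(n,m)=m\sum_{d\mid n}\varphi(d)\,t_{\mathrm{id}}^{n(m-1)/\mathrm{lcm}(d,2)}t_{(r^2f)^d}^{n/d}\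 \text{ if } m \text{ odd}.$$ Here $\varphi$ is Euler's totient function.
   Context: Cells: $\mathbb{Z}/n\mathbb{Z}\times\mathbb{Z}/m\mathbb{Z}$. $D_4=\langle r^2,f\mid (r^2)^2=f^2=\mathrm{id}\rangle$ acts on cells on the right by $(x,y)\cdot f=(n-1-x,y)$, $(x,y)\cdot r^2=(n-1-x,m-1-y)$, $(x,y)\cdot r^2f=(x,m-1-y)$. For $(a,b)\in\mathbb{Z}/n\mathbb{Z}\times\mathbb{Z}/m\mathbb{Z}$ and $g\in R$, $(x,y)\cdot((a,b),g)=(x+a,y+b)\cdot g$. A set of tile designs for $R$ is a finite set $T$ with a right $R$-action; $t_g=|\{d\in T:d\cdot g=d\}|$. A tiling is a map $\tau$ from cells to $T$; $\tau$ is fixed by $s=((a,b),g)$ if $\tau(c\cdot s)=\tau(c)\cdot g$ for all cells $c$. -}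

module Defs where

open import Data.Nat using (ℕ; zero; suc; _+_; _*_; _/_)
open import Data.Nat.ListAction using (sum)
open import Data.Nat.DivMod using (_mod_)
open import Data.Nat.Divisibility using (_∣?_)
open import Data.Nat.GCD using (gcd)
open import Data.Nat.Properties using () renaming (_≟_ to _≟ℕ_)
open import Data.Bool using (Bool; true; false)
open import Data.Fin using (Fin; toℕ; opposite) renaming (_≟_ to _≟F_)
open import Data.Fin.Properties using (all?)
open import Data.List using (List; []; _∷_; map; concatMap; filter; length; allFin; upTo)
import Data.Vec.Functional as VF
open import Data.Product using (Σ; _,_; proj₁; proj₂; _×_)
open import Relation.Binary.PropositionalEquality using (_≡_)

-- The group: the subgroup {id, f, r², r²f} of D4 used in the paper,
-- i.e. the group generated by r² and f (Klein four-group).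

data D4 : Set where
  e r2 fl r2f : D4

_·_ : D4 → D4 → D4
e   · h   = h
g   · e   = g
r2  · r2  = e
r2  · fl  = r2f
r2  · r2f = fl
fl  · r2  = r2f
fl  · fl  = e
fl  · r2f = r2
r2f · r2  = fl
r2f · fl  = r2
r2f · r2f = e

_^ᴳ_ : D4 → ℕ → D4
g ^ᴳ zero  = e
g ^ᴳ suc c = g · (g ^ᴳ c)

-- Subgroups R ≤ D4 (given by a Boolean membership predicate closed under
-- the identity and multiplication; inverses are automatic since every
-- element is its own inverse).

record Subgroup : Set where
  field
    mem     : D4 → Bool
    mem-e   : mem e ≡ true
    mem-mul : ∀ {g h} → mem g ≡ true → mem h ≡ true → mem (g · h) ≡ true

open Subgroup public

El : Subgroup → Set
El R = Σ D4 (λ g → mem R g ≡ true)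

eᴿ : (R : Subgroup) → El R
eᴿ R = e , mem-e R

_·ᴿ_ : {R : Subgroup} → El R → El R → El R
_·ᴿ_ {R} (g , p) (h , q) = g · h , mem-mul R p q

powᴿ : {R : Subgroup} → El R → ℕ → El R
powᴿ {R} g zero    = eᴿ R
powᴿ {R} g (suc c) = _·ᴿ_ {R} g (powᴿ {R} g c)

-- A set of tile designs for R: a finite set (WLOG Fin k) with a right
-- R-action.

record TileSet (R : Subgroup) : Set where
  field
    k       : ℕ
    act     : Fin k → El R → Fin k
    act-e   : ∀ d → act d (eᴿ R) ≡ d
    act-mul : ∀ d g h → act (act d g) h ≡ act d (_·ᴿ_ {R} g h)

open TileSet public

tcount : {R : Subgroup} → TileSet R → El R → ℕ
tcount T g = length (filter (λ d → act T d g ≟F d) (allFin (k T)))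

addMod : ∀ {n} → Fin n → Fin n → Fin n
addMod {suc n} a b = (toℕ a + toℕ b) mod (suc n)

Cell : ℕ → ℕ → Set
Cell n m = Fin n × Fin m

cellAct : ∀ {n m} → D4 → Cell n m → Cell n m
cellAct e   (x , y) = x , y
cellAct fl  (x , y) = opposite x , y
cellAct r2  (x , y) = opposite x , opposite y
cellAct r2f (x , y) = x , opposite y

cellActS : ∀ {n m} → Fin n → Fin m → D4 → Cell n m → Cell n m
cellActS a b g (x , y) = cellAct g (addMod x a , addMod y b)

allFuns : ∀ n {B : Set} → List B → List (Fin n → B)
allFuns zero    bs = (λ ()) ∷ []
allFuns (suc n) bs = concatMap (λ b → map (λ g → b VF.∷ g) (allFuns n bs)) bs

Tiling : ∀ {R} → ℕ → ℕ → TileSet R → Set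
Tiling n m T = Fin n → Fin m → Fin (k T)

allTilings : ∀ {R} n m (T : TileSet R) → List (Tiling n m T)
allTilings n m T = allFuns n (allFuns m (allFin (k T)))

fixedBy? : ∀ {R n m} (T : TileSet R) (a : Fin n) (b : Fin m) (g : El R)
           (τ : Tiling n m T) →
           _
fixedBy? {n = n} {m} T a b g τ =
  all? (λ x → all? (λ y →
    let c' = cellActS a b (proj₁ g) (x , y) in
    τ (proj₁ c') (proj₂ c') ≟F act T (τ x y) g))

fixCount : ∀ {R n m} (T : TileSet R) → Fin n → Fin m → El R → ℕ
fixCount {n = n} {m} T a b g = length (filter (fixedBy? T a b g) (allTilings n m T))

FixTor : ∀ {R} (T : TileSet R) (n m : ℕ) → El R → ℕ
FixTor T n m g = sum (map (λ a → sum (map (λ b → fixCount T a b g) (allFin m))) (allFin n))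

-- natural-number division, with x div 0 = 0 (only used with nonzero divisors)
_div_ : ℕ → ℕ → ℕ
x div zero  = zero
x div suc d = x / suc d

divSum : ℕ → (ℕ → ℕ) → ℕ
divSum m F = sum (map F (filter (_∣? m) (map suc (upTo m))))

totient : ℕ → ℕ
totient c = length (filter (λ j → gcd j c ≟ℕ 1) (map suc (upTo c)))

-- A tiling fixed by ((a , b) , f) is a family of columns v_x : ℤ/m → T (x ∈ ℤ/n) with v_{σ x} = L v_x, where
-- σ x = n − 1 − (x + a) is an involution of ℤ/n and L v = h ∘ v ∘ (· − b) for the involution h = (· f)
-- of T. Such a family is free on a set of representatives of the σ-orbits: a column at a fixed point of σ
-- must be L-fixed, a pair {x , σ x} carries one L²-fixed column. Counting columns along the orbits of
-- y ↦ y + b on ℤ/m, there are #fix(h^c)^g L-fixed and t_id^{g₂} L²-fixed ones, where g = gcd(b , m),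
-- c = m / g, g₂ = gcd(2b , m). σ has one fixed point when n is odd, and none or two (according to the
-- parity of a) when n is even. Summing over b, grouped by its order c in ℤ/m (attained φ(c) times), and
-- using g₂ · lcm(2 , c) = 2m gives the formula. The case r²f is the transpose of the case f.

module Submission where

open import Level using (0ℓ)
open import Function using (_∘_)
open import Data.Empty using (⊥; ⊥-elim)
open import Data.Unit using (⊤; tt)
open import Data.Bool using (true)
import Data.Bool as Bool
open import Data.Product using (Σ; ∃; _,_; proj₁; proj₂; _×_)
open import Data.Sum using (_⊎_; inj₁; inj₂; [_,_])
open import Relation.Nullary using (¬_; Dec; yes; no; _⊎-dec_)
open import Relation.Binary.Bundles using (Setoid)
open import Relation.Binary.Definitions using (tri<; tri≈; tri>)
open import Relation.Binary.PropositionalEquality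
  using (_≡_; _≢_; refl; cong; cong₂; sym; trans; subst; subst₂; module ≡-Reasoning)
import Relation.Binary.PropositionalEquality.Properties as ≡
open import Axiom.UniquenessOfIdentityProofs using (module Decidable⇒UIP)

open import Data.Nat using (ℕ; zero; suc; _+_; _*_; _^_; _∸_; _≤_; _<_; s≤s; z≤n; NonZero; ≢-nonZero; >-nonZero; >-nonZero⁻¹)
open import Data.Nat.Properties
open import Data.Nat.DivMod hiding (_div_)
open import Data.Nat.Divisibility
  using (_∣?_; _∣_; divides; ∣⇒≤; n∣m*n; *-cancelʳ-∣; ∣-antisym; ∣-trans; ∣n∣m%n⇒∣m; %-presˡ-∣; m/n∣m)
open import Data.Nat.GCD
  using (gcd; gcd[m,n]∣m; gcd[m,n]∣n; gcd[m,n]≢0; gcd[m,n]≤n; gcd-zeroˡ; gcd-identityˡ; gcd-greatest; c*gcd[m,n]≡gcd[cm,cn])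
open import Data.Nat.LCM using (lcm; gcd*lcm; lcm-comm)
open import Data.Nat.Coprimality as Coprime using (Coprime; coprime-divisor; coprime-/gcd)
open import Data.Nat.ListAction using (sum; product)
open import Algebra.Properties.CommutativeSemigroup +-commutativeSemigroup
  using (interchange) renaming (x∙yz≈y∙xz to x+[y+z]≡y+[x+z])
open import Algebra.Properties.CommutativeSemigroup *-commutativeSemigroup
  using () renaming (x∙yz≈y∙xz to x*[y*z]≡y*[x*z])

open import Data.Fin using (Fin; zero; suc; toℕ; fromℕ<; opposite; punchOut) renaming (_<_ to _<ᶠ_; _<?_ to _<ᶠ?_)
open import Data.Fin.Properties
  using (all?; any?; toℕ-injective; toℕ-fromℕ<; toℕ<n; opposite-prop; punchOut-injective; injective⇒≤)
  renaming (_≟_ to _≟ᶠ_; <-irrefl to <ᶠ-irrefl; <-asym to <ᶠ-asym)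
import Data.Vec.Functional as Vec
import Data.Vec.Functional.Relation.Binary.Pointwise.Properties as Pointwise

open import Data.List using (List; []; _∷_; map; concat; concatMap; filter; length; allFin; tabulate; upTo)
open import Data.List.Properties
  using (length-map; length-++; length-removeAt′; map-tabulate; length-tabulate; filter-≐; filter-all; filter-none; filter-accept; filter-reject)
open import Data.List.Relation.Unary.All as All using (All; []; _∷_)
import Data.List.Relation.Unary.All.Properties as All
open import Data.List.Relation.Unary.Any as Any using (Any; here; there; _─_; index)
import Data.List.Relation.Unary.Any.Properties as Any
open import Data.List.Relation.Unary.AllPairs as AllPairs using (AllPairs; []; _∷_)
import Data.List.Relation.Unary.AllPairs.Properties as AllPairs
open import Data.List.Relation.Unary.Unique.Propositional.Properties using (allFin⁺; upTo⁺)
open import Data.List.Membership.Propositional using (_∈_)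
open import Data.List.Membership.Propositional.Properties using (∈-allFin; ∈-upTo⁺; ∈-upTo⁻; ∈-map⁻)

open import Defs
  using (D4; fl; r2f; _·_; Subgroup; mem; El; eᴿ; powᴿ; TileSet; act; act-e; act-mul; tcount;
         addMod; allFuns; FixTor; _div_; divSum; totient)
  renaming (e to idᴰ; k to #tiles)

open ≡-Reasoning

-- xs lists the elements satisfying P, each exactly once up to the setoid equality; vectors and
-- tilings are compared pointwise since function extensionality is not available.
record Enumeration (S : Setoid 0ℓ 0ℓ) (P : Setoid.Carrier S → Set) (xs : List (Setoid.Carrier S)) : Set where
  constructor mkEnumeration
  open Setoid S
  field
    sound    : All P xs
    distinct : AllPairs (λ x y → ¬ x ≈ y) xs
    complete : ∀ x → P x → Any (x ≈_) xs

open Enumeration public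

module _ {S : Setoid 0ℓ 0ℓ} where
  open Setoid S using (_≈_) renaming (Carrier to A; sym to ≈-sym; trans to ≈-trans)

  private
    Distinct : List A → Set
    Distinct = AllPairs (λ x y → ¬ x ≈ y)

  ─-distinct : ∀ {Q : A → Set} {ys} (p : Any Q ys) → Distinct ys → Distinct (ys ─ p)
  ─-distinct (here _)  (_ ∷ d) = d
  ─-distinct (there p) (r ∷ d) = All.─⁺ p r ∷ ─-distinct p d

  ─-avoids : ∀ {x ys} (p : Any (x ≈_) ys) → Distinct ys → All (λ z → ¬ z ≈ x) (ys ─ p)
  ─-avoids (here x≈y) (y≉ ∷ _) = All.map (λ y≉z z≈x → y≉z (≈-trans (≈-sym x≈y) (≈-sym z≈x))) y≉
  ─-avoids {x} {y ∷ _} (there p) (y≉ ∷ d) = y≉x ∷ ─-avoids p d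
    where
    y≉x : ¬ y ≈ x
    y≉x y≈x with All.lookupAny y≉ p
    ... | y≉z , x≈z = y≉z (≈-trans y≈x x≈z)

  ─-complete : ∀ {x z ys} (p : Any (x ≈_) ys) → Any (z ≈_) ys → ¬ z ≈ x → Any (z ≈_) (ys ─ p)
  ─-complete (here x≈y) (here z≈y) z≉x = ⊥-elim (z≉x (≈-trans z≈y (≈-sym x≈y)))
  ─-complete (here _)   (there q)  _   = q
  ─-complete (there _)  (here z≈y) _   = here z≈y
  ─-complete (there p)  (there q)  z≉x = there (─-complete p q z≉x)

  enumeration-length : ∀ {P xs ys} → Enumeration S P xs → Enumeration S P ys → length xs ≡ length ys
  enumeration-length {xs = []} {[]} _ _ = refl
  enumeration-length {xs = []} {y ∷ _} ex ey with complete ex y (All.head (sound ey))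
  ... | ()
  enumeration-length {P} {x ∷ xs} {ys} ex ey =
    trans (cong suc (enumeration-length ex′ ey′)) (sym (length-removeAt′ ys (index x∈ys)))
    where
    x∈ys : Any (x ≈_) ys
    x∈ys = complete ey x (All.head (sound ex))
    P′ : A → Set
    P′ z = P z × ¬ z ≈ x
    ex′ : Enumeration S P′ xs
    ex′ = mkEnumeration
      (All.zip (All.tail (sound ex) , All.map (λ x≉z z≈x → x≉z (≈-sym z≈x)) (AllPairs.head (distinct ex))))
      (AllPairs.tail (distinct ex))
      (λ { z (pz , z≉x) → drop-head z≉x (complete ex z pz) })
      where
      drop-head : ∀ {z} → ¬ z ≈ x → Any (z ≈_) (x ∷ xs) → Any (z ≈_) xs
      drop-head z≉x (here z≈x) = ⊥-elim (z≉x z≈x)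
      drop-head _   (there q)  = q
    ey′ : Enumeration S P′ (ys ─ x∈ys)
    ey′ = mkEnumeration
      (All.zip (All.─⁺ x∈ys (sound ey) , ─-avoids x∈ys (distinct ey)))
      (─-distinct x∈ys (distinct ey))
      (λ { z (pz , z≉x) → ─-complete x∈ys (complete ey z pz) z≉x })

module _ {S : Setoid 0ℓ 0ℓ} where
  open Setoid S using (_≈_) renaming (Carrier to A)

  filter-enumeration : ∀ {P Q : A → Set} {xs} (Q? : ∀ x → Dec (Q x)) → (∀ {x y} → x ≈ y → Q x → Q y) →
                       Enumeration S P xs → Enumeration S (λ x → P x × Q x) (filter Q? xs)
  filter-enumeration {Q = Q} {xs} Q? Q-resp en = mkEnumeration
    (All.zip (All.filter⁺ Q? (sound en) , All.all-filter Q? xs))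
    (AllPairs.filter⁺ Q? (distinct en))
    (λ { x (px , qx) → kept qx (complete en x px) })
    where
    kept : ∀ {x} → Q x → (x∈ : Any (x ≈_) xs) → Any (x ≈_) (filter Q? xs)
    kept qx x∈ with Any.filter⁺ Q? x∈
    ... | inj₁ x∈′ = x∈′
    ... | inj₂ ¬q  = ⊥-elim (¬q (Q-resp (Any.lookup-result x∈) qx))

module _ {S T : Setoid 0ℓ 0ℓ} where
  open Setoid S using (_≈_) renaming (Carrier to A)
  open Setoid T using () renaming (Carrier to B; _≈_ to _≈′_; trans to ≈′-trans)

  map-enumeration : ∀ {P : A → Set} {Q : B → Set} {xs} (F : A → B) →
    (∀ {x y} → x ≈ y → F x ≈′ F y) →
    (∀ x → P x → Q (F x)) →
    (∀ {x y} → P x → P y → F x ≈′ F y → x ≈ y) →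
    (∀ z → Q z → ∃ λ x → P x × z ≈′ F x) →
    Enumeration S P xs → Enumeration T Q (map F xs)
  map-enumeration {P} {Q} {xs} F F-cong P⇒Q F-injective F-onto en = mkEnumeration
    (All.map⁺ (All.map (λ {x} → P⇒Q x) (sound en)))
    (distinct′ (sound en) (distinct en))
    (λ z qz → onto z qz)
    where
    distinct′ : ∀ {ys} → All P ys → AllPairs (λ x y → ¬ x ≈ y) ys → AllPairs (λ x y → ¬ x ≈′ y) (map F ys)
    distinct′ []         []         = []
    distinct′ (px ∷ pys) (x≉ ∷ d) =
      All.map⁺ (All.zipWith (λ { (py , x≉y) Fx≈Fy → x≉y (F-injective px py Fx≈Fy) }) (pys , x≉)) ∷ distinct′ pys d
    onto : ∀ z → Q z → Any (z ≈′_) (map F xs)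
    onto z qz with F-onto z qz
    ... | x , px , z≈Fx = Any.map⁺ (Any.map (λ x≈y → ≈′-trans z≈Fx (F-cong x≈y)) (complete en x px))


AllPairs-concat⁺ : ∀ {A : Set} {R : A → A → Set} {xss : List (List A)} →
  All (AllPairs R) xss → AllPairs (λ xs ys → All (λ x → All (R x) ys) xs) xss → AllPairs R (concat xss)
AllPairs-concat⁺ []           []         = []
AllPairs-concat⁺ (rxs ∷ rxss) (c ∷ cs) =
  AllPairs.++⁺ rxs (AllPairs-concat⁺ rxss cs) (All.tabulate λ x∈ → All.concat⁺ (All.map (λ r → All.lookup r x∈) c))

Vectors : Setoid 0ℓ 0ℓ → ℕ → Setoid 0ℓ 0ℓ
Vectors = Pointwise.setoid

TileVectors : ℕ → ℕ → Setoid 0ℓ 0ℓ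
TileVectors k M = Vectors (≡.setoid (Fin k)) M

allFunsWith : ∀ n {B : Set} → (Fin n → List B) → List (Fin n → B)
allFunsWith zero    Ls = (λ ()) ∷ []
allFunsWith (suc n) Ls = concatMap (λ b → map (b Vec.∷_) (allFunsWith n (λ i → Ls (suc i)))) (Ls zero)

module _ {S : Setoid 0ℓ 0ℓ} where
  open Setoid S using (_≈_) renaming (Carrier to A)

  allFunsWith-enumeration : ∀ n (Q : Fin n → A → Set) (Ls : Fin n → List A) →
    (∀ i → Enumeration S (Q i) (Ls i)) →
    Enumeration (Vectors S n) (λ f → ∀ i → Q i (f i)) (allFunsWith n Ls)
  allFunsWith-enumeration zero    Q Ls _   = mkEnumeration ((λ ()) ∷ []) ([] ∷ []) (λ _ _ → here (λ ()))
  allFunsWith-enumeration (suc n) Q Ls ens = mkEnumeration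
    (All.concat⁺ (All.map⁺ (All.map (λ qb → All.map⁺ (All.map (cons-Q qb) (sound enG))) (sound (ens zero)))))
    (AllPairs-concat⁺
      (All.map⁺ (All.tabulate λ _ → AllPairs.map⁺ (AllPairs.map (λ g≉h b∷g≈b∷h → g≉h (λ i → b∷g≈b∷h (suc i))) (distinct enG))))
      (AllPairs.map⁺ (AllPairs.map (λ b≉b′ → All.map⁺ (All.tabulate λ _ → All.map⁺ (All.tabulate λ _ f≈g → b≉b′ (f≈g zero))))
                                   (distinct (ens zero)))))
    (λ f qf → find (complete (ens zero) (f zero) (qf zero)) (complete enG (λ i → f (suc i)) (λ i → qf (suc i))))
    where
    G : List (Fin n → A)
    G = allFunsWith n (λ i → Ls (suc i))
    enG : Enumeration (Vectors S n) (λ g → ∀ i → Q (suc i) (g i)) G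
    enG = allFunsWith-enumeration n (λ i → Q (suc i)) (λ i → Ls (suc i)) (λ i → ens (suc i))
    block : A → List (Fin (suc n) → A)
    block b = map (b Vec.∷_) G
    cons-Q : ∀ {b g} → Q zero b → (∀ i → Q (suc i) (g i)) → ∀ i → Q i ((b Vec.∷ g) i)
    cons-Q qb qg zero    = qb
    cons-Q qb qg (suc i) = qg i
    find : ∀ {f : Fin (suc n) → A} {bs} → Any (f zero ≈_) bs → Any (λ g → ∀ i → f (suc i) ≈ g i) G →
           Any (λ g → ∀ i → f i ≈ g i) (concat (map block bs))
    find (here f0≈b) tail∈ = Any.++⁺ˡ (Any.map⁺ (Any.map (λ tail≈g → λ { zero → f0≈b ; (suc i) → tail≈g i }) tail∈))
    find {bs = b ∷ _} (there head∈) tail∈ = Any.++⁺ʳ (block b) (find head∈ tail∈)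

length-concatMap-map : ∀ {A B C : Set} (f : A → B → C) (as : List A) (bs : List B) →
  length (concatMap (λ a → map (f a) bs) as) ≡ length as * length bs
length-concatMap-map f []       bs = refl
length-concatMap-map f (a ∷ as) bs =
  trans (length-++ (map (f a) bs)) (cong₂ _+_ (length-map (f a) bs) (length-concatMap-map f as bs))

length-allFunsWith : ∀ n {B : Set} (Ls : Fin n → List B) →
  length (allFunsWith n Ls) ≡ product (map (λ i → length (Ls i)) (allFin n))
length-allFunsWith zero    Ls = refl
length-allFunsWith (suc n) Ls = trans (length-concatMap-map Vec._∷_ (Ls zero) _) (cong (length (Ls zero) *_) (begin
  length (allFunsWith n (λ i → Ls (suc i)))                  ≡⟨ length-allFunsWith n (λ i → Ls (suc i)) ⟩
  product (map (λ i → length (Ls (suc i))) (allFin n))      ≡⟨ cong product (map-tabulate (λ i → i) (λ i → length (Ls (suc i)))) ⟩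
  product (tabulate (λ i → length (Ls (suc i))))             ≡⟨ cong product (map-tabulate suc (λ i → length (Ls i))) ⟨
  product (map (λ i → length (Ls i)) (tabulate suc))         ∎))

length-allFuns : ∀ n {B : Set} (bs : List B) → length (allFuns n bs) ≡ length bs ^ n
length-allFuns zero    bs = refl
length-allFuns (suc n) bs = trans (length-concatMap-map Vec._∷_ bs _) (cong (length bs *_) (length-allFuns n bs))

allFuns≡allFunsWith : ∀ n {B : Set} (bs : List B) → allFuns n bs ≡ allFunsWith n (λ _ → bs)
allFuns≡allFunsWith zero    bs = refl
allFuns≡allFunsWith (suc n) bs = cong (λ G → concatMap (λ b → map (b Vec.∷_) G) bs) (allFuns≡allFunsWith n bs)

module _ {S : Setoid 0ℓ 0ℓ} where
  open Setoid S using (_≈_) renaming (Carrier to A)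

  allFuns-enumeration : ∀ n {Q : A → Set} {bs} → Enumeration S Q bs →
    Enumeration (Vectors S n) (λ f → ∀ i → Q (f i)) (allFuns n bs)
  allFuns-enumeration n {bs = bs} en =
    subst (Enumeration _ _) (sym (allFuns≡allFunsWith n bs)) (allFunsWith-enumeration n _ (λ _ → bs) (λ _ → en))

  allFuns-enumeration-⊤ : ∀ n {bs} → Enumeration S (λ _ → ⊤) bs →
    Enumeration (Vectors S n) (λ _ → ⊤) (allFuns n bs)
  allFuns-enumeration-⊤ n en with allFuns-enumeration n en
  ... | mkEnumeration _ d c = mkEnumeration (All.tabulate λ _ → tt) d (λ f _ → c f (λ _ → tt))

allFin-enumeration : ∀ k → Enumeration (≡.setoid (Fin k)) (λ _ → ⊤) (allFin k)
allFin-enumeration k = mkEnumeration (All.tabulate λ _ → tt) (allFin⁺ k) (λ x _ → ∈-allFin x)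

injective⇒surjective : ∀ {N} (f : Fin N → Fin N) → (∀ {x y} → f x ≡ f y → x ≡ y) → ∀ y → ∃ λ x → f x ≡ y
injective⇒surjective {suc N} f f-injective y with any? (λ x → f x ≟ᶠ y)
... | yes hit = hit
... | no miss = ⊥-elim (n≮n N (injective⇒≤ {f = skip-y} skip-y-injective))
  where
  f≢y : ∀ x → f x ≢ y
  f≢y x fx≡y = miss (x , fx≡y)
  skip-y : Fin (suc N) → Fin N
  skip-y x = punchOut (λ y≡fx → f≢y x (sym y≡fx))
  skip-y-injective : ∀ {x x′} → skip-y x ≡ skip-y x′ → x ≡ x′
  skip-y-injective {x} {x′} eq = f-injective (punchOut-injective (λ y≡fx → f≢y x (sym y≡fx)) (λ y≡fx → f≢y x′ (sym y≡fx)) eq)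

module InjectiveEndo {N : ℕ} (f : Fin N → Fin N) (f-injective : ∀ {x y} → f x ≡ f y → x ≡ y) where

  f⁻¹ : Fin N → Fin N
  f⁻¹ y = proj₁ (injective⇒surjective f f-injective y)

  f∘f⁻¹ : ∀ y → f (f⁻¹ y) ≡ y
  f∘f⁻¹ y = proj₂ (injective⇒surjective f f-injective y)

  f⁻¹∘f : ∀ x → f⁻¹ (f x) ≡ x
  f⁻¹∘f x = f-injective (f∘f⁻¹ (f x))

#[_] : {A : Set} {Q : A → Set} → (∀ x → Dec (Q x)) → List A → ℕ
#[ Q? ] xs = length (filter Q? xs)

module _ {A : Set} {P : A → Set} (P? : ∀ x → Dec (P x)) where

  #-cong : ∀ {Q : A → Set} (Q? : ∀ x → Dec (Q x)) → (∀ {x} → P x → Q x) → (∀ {x} → Q x → P x) → ∀ xs → #[ P? ] xs ≡ #[ Q? ] xs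
  #-cong Q? P⇒Q Q⇒P xs = cong length (filter-≐ P? Q? (P⇒Q , Q⇒P) xs)

  #-accept : ∀ {x} xs → P x → #[ P? ] (x ∷ xs) ≡ suc (#[ P? ] xs)
  #-accept xs px = cong length (filter-accept P? px)

  #-reject : ∀ {x} xs → ¬ P x → #[ P? ] (x ∷ xs) ≡ #[ P? ] xs
  #-reject xs ¬px = cong length (filter-reject P? ¬px)

  #-all : ∀ {xs} → All P xs → #[ P? ] xs ≡ length xs
  #-all all = cong length (filter-all P? all)

  #-none : ∀ {xs} → All (λ x → ¬ P x) xs → #[ P? ] xs ≡ 0
  #-none none = cong length (filter-none P? none)

#-⊎ : ∀ {A : Set} {P Q : A → Set} (P? : ∀ x → Dec (P x)) (Q? : ∀ x → Dec (Q x)) (P⊎Q? : ∀ x → Dec (P x ⊎ Q x)) →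
      (∀ {x} → P x → Q x → ⊥) → ∀ xs → #[ P⊎Q? ] xs ≡ #[ P? ] xs + #[ Q? ] xs
#-⊎ P? Q? P⊎Q? disjoint [] = refl
#-⊎ P? Q? P⊎Q? disjoint (x ∷ xs) with P? x | Q? x
... | yes p | yes q = ⊥-elim (disjoint p q)
... | yes p | no _  = trans (#-accept P⊎Q? xs (inj₁ p)) (cong suc (#-⊎ P? Q? P⊎Q? disjoint xs))
... | no _  | yes q = trans (#-accept P⊎Q? xs (inj₂ q)) (trans (cong suc (#-⊎ P? Q? P⊎Q? disjoint xs)) (sym (+-suc _ _)))
... | no ¬p | no ¬q = trans (#-reject P⊎Q? xs [ ¬p , ¬q ]) (#-⊎ P? Q? P⊎Q? disjoint xs)

module _ {A : Set} where

  sum-cong : ∀ {f g : A → ℕ} {xs} → All (λ x → f x ≡ g x) xs → sum (map f xs) ≡ sum (map g xs)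
  sum-cong []         = refl
  sum-cong (eq ∷ eqs) = cong₂ _+_ eq (sum-cong eqs)

  sum-zero : ∀ {f : A → ℕ} {xs} → All (λ x → f x ≡ 0) xs → sum (map f xs) ≡ 0
  sum-zero []         = refl
  sum-zero (eq ∷ eqs) = cong₂ _+_ eq (sum-zero eqs)

  sum-+ : ∀ (f g : A → ℕ) xs → sum (map (λ x → f x + g x) xs) ≡ sum (map f xs) + sum (map g xs)
  sum-+ f g []       = refl
  sum-+ f g (x ∷ xs) = trans (cong (f x + g x +_) (sum-+ f g xs)) (interchange (f x) (g x) _ _)

  sum-const : ∀ n (xs : List A) → sum (map (λ _ → n) xs) ≡ length xs * n
  sum-const n []       = refl
  sum-const n (x ∷ xs) = cong (n +_) (sum-const n xs)

sum-swap : ∀ {A B : Set} (f : A → B → ℕ) xs ys →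
  sum (map (λ a → sum (map (f a) ys)) xs) ≡ sum (map (λ b → sum (map (λ a → f a b) xs)) ys)
sum-swap f []       ys = sym (sum-zero {xs = ys} (All.tabulate λ _ → refl))
sum-swap f (x ∷ xs) ys = trans (cong (sum (map (f x) ys) +_) (sum-swap f xs ys)) (sym (sum-+ (f x) _ ys))

toℕ-mod : ∀ a N .{{_ : NonZero N}} → toℕ (a mod N) ≡ a % N
toℕ-mod a N = toℕ-fromℕ< _

module _ {n : ℕ} .{{_ : NonZero n}} where

  r<n⇒[r+q*n]/n≡q : ∀ {r} q → r < n → (r + q * n) / n ≡ q
  r<n⇒[r+q*n]/n≡q {r} q r<n = trans (+-distrib-/-∣ʳ r (n∣m*n q)) (cong₂ _+_ (m<n⇒m/n≡0 r<n) (m*n/n≡m q n))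

  r<n⇒[r+q*n]%n≡r : ∀ {r} q → r < n → (r + q * n) % n ≡ r
  r<n⇒[r+q*n]%n≡r {r} q r<n = trans ([m+kn]%n≡m%n r q n) (m<n⇒m%n≡m r<n)

  [m%n+o]%n≡[m+o]%n : ∀ m o → (m % n + o) % n ≡ (m + o) % n
  [m%n+o]%n≡[m+o]%n m o = begin
    (m % n + o) % n         ≡⟨ %-distribˡ-+ (m % n) o n ⟩
    (m % n % n + o % n) % n ≡⟨ %-congˡ (cong (_+ o % n) (m%n%n≡m%n m n)) ⟩
    (m % n + o % n) % n     ≡⟨ %-distribˡ-+ m o n ⟨
    (m + o) % n             ∎

  %-≡⇒∣∸ : ∀ a b → a % n ≡ b % n → n ∣ b ∸ a
  %-≡⇒∣∸ a b a≡b = divides (b / n ∸ a / n) (begin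
    b ∸ a                                        ≡⟨ cong₂ _∸_ (m≡m%n+[m/n]*n b n) (m≡m%n+[m/n]*n a n) ⟩
    (b % n + (b / n) * n) ∸ (a % n + (a / n) * n) ≡⟨ cong (λ t → (t + (b / n) * n) ∸ (a % n + (a / n) * n)) a≡b ⟨
    (a % n + (b / n) * n) ∸ (a % n + (a / n) * n) ≡⟨ [m+n]∸[m+o]≡n∸o (a % n) _ _ ⟩
    (b / n) * n ∸ (a / n) * n                     ≡⟨ *-distribʳ-∸ n (b / n) (a / n) ⟨
    (b / n ∸ a / n) * n                           ∎)

∣∧<⇒≡0 : ∀ {n d} → n ∣ d → d < n → d ≡ 0
∣∧<⇒≡0 {d = zero}  _   _   = refl
∣∧<⇒≡0 {d = suc _} n∣d d<n = ⊥-elim (<⇒≱ d<n (∣⇒≤ n∣d))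

∣∸∧<⇒≡ : ∀ {n a b} → a ≤ b → b ∸ a < n → n ∣ b ∸ a → a ≡ b
∣∸∧<⇒≡ a≤b b∸a<n n∣b∸a = ≤-antisym a≤b (m∸n≡0⇒m≤n (∣∧<⇒≡0 n∣b∸a b∸a<n))

module _ {M′ : ℕ} where
  private
    M : ℕ
    M = suc M′

  shift : ℕ → Fin M → Fin M
  shift s y = (toℕ y + s) mod M

  private
    shift-injective-≤ : ∀ s {a b : Fin M} → toℕ a ≤ toℕ b → shift s a ≡ shift s b → toℕ a ≡ toℕ b
    shift-injective-≤ s {a} {b} a≤b eq = ∣∸∧<⇒≡ a≤b (≤-<-trans (m∸n≤m (toℕ b) (toℕ a)) (toℕ<n b))
      (subst (M ∣_) ([m+n]∸[m+o]≡n∸o s (toℕ b) (toℕ a))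
        (%-≡⇒∣∸ (s + toℕ a) (s + toℕ b) (subst₂ (λ u v → u % M ≡ v % M) (+-comm (toℕ a) s) (+-comm (toℕ b) s)
          (trans (sym (toℕ-mod (toℕ a + s) M)) (trans (cong toℕ eq) (toℕ-mod (toℕ b + s) M))))))

  shift-injective : ∀ s {y y′} → shift s y ≡ shift s y′ → y ≡ y′
  shift-injective s {y} {y′} eq with ≤-total (toℕ y) (toℕ y′)
  ... | inj₁ y≤y′ = toℕ-injective (shift-injective-≤ s y≤y′ eq)
  ... | inj₂ y′≤y = toℕ-injective (sym (shift-injective-≤ s y′≤y (sym eq)))

  toℕ-shift : ∀ s y → toℕ (shift s y) ≡ (toℕ y + s) % M
  toℕ-shift s y = toℕ-mod (toℕ y + s) M

  shift∘shift : ∀ s t y → shift t (shift s y) ≡ shift (s + t) y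
  shift∘shift s t y = toℕ-injective (begin
    toℕ (shift t (shift s y))        ≡⟨ toℕ-shift t (shift s y) ⟩
    (toℕ (shift s y) + t) % M        ≡⟨ %-congˡ (cong (_+ t) (toℕ-shift s y)) ⟩
    ((toℕ y + s) % M + t) % M        ≡⟨ [m%n+o]%n≡[m+o]%n (toℕ y + s) t ⟩
    (toℕ y + s + t) % M              ≡⟨ %-congˡ (+-assoc (toℕ y) s t) ⟩
    (toℕ y + (s + t)) % M            ≡⟨ toℕ-shift (s + t) y ⟨
    toℕ (shift (s + t) y)            ∎)

  reflect : Fin M → Fin M → Fin M
  reflect a x = opposite (addMod x a)

  toℕ-reflect : ∀ a x → toℕ (reflect a x) ≡ M′ ∸ (toℕ x + toℕ a) % M
  toℕ-reflect a x = trans (opposite-prop (addMod x a)) (cong (M′ ∸_) (toℕ-mod (toℕ x + toℕ a) M))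

  reflect-involutive : ∀ a x → reflect a (reflect a x) ≡ x
  reflect-involutive a x = toℕ-injective (begin
    toℕ (reflect a (reflect a x))   ≡⟨ toℕ-reflect a (reflect a x) ⟩
    M′ ∸ (toℕ (reflect a x) + A) % M ≡⟨ cong (λ t → M′ ∸ (t + A) % M) (toℕ-reflect a x) ⟩
    M′ ∸ ((M′ ∸ t) + A) % M          ≡⟨ cong (λ u → M′ ∸ u % M) unfold ⟩
    M′ ∸ ((M′ ∸ X) + q * M) % M      ≡⟨ cong (M′ ∸_) ([m+kn]%n≡m%n (M′ ∸ X) q M) ⟩
    M′ ∸ (M′ ∸ X) % M                ≡⟨ cong (M′ ∸_) (m<n⇒m%n≡m (s≤s (m∸n≤m M′ X))) ⟩
    M′ ∸ (M′ ∸ X)                    ≡⟨ m∸[m∸n]≡n X≤M′ ⟩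
    X                                ∎)
    where
    X : ℕ
    X = toℕ x
    A : ℕ
    A = toℕ a
    X≤M′ : X ≤ M′
    X≤M′ = ≤-pred (toℕ<n x)
    t : ℕ
    t = (X + A) % M
    q : ℕ
    q = (X + A) / M
    t≤M′ : t ≤ M′
    t≤M′ = ≤-pred (m%n<n (X + A) M)
    unfold : (M′ ∸ t) + A ≡ (M′ ∸ X) + q * M
    unfold = +-cancelʳ-≡ X _ _ (begin
      (M′ ∸ t) + A + X        ≡⟨ +-assoc (M′ ∸ t) A X ⟩
      (M′ ∸ t) + (A + X)      ≡⟨ cong ((M′ ∸ t) +_) (trans (+-comm A X) (m≡m%n+[m/n]*n (X + A) M)) ⟩
      (M′ ∸ t) + (t + q * M)  ≡⟨ +-assoc (M′ ∸ t) t (q * M) ⟨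
      (M′ ∸ t) + t + q * M    ≡⟨ cong (_+ q * M) (trans (m∸n+n≡m t≤M′) (sym (m∸n+n≡m X≤M′))) ⟩
      (M′ ∸ X) + X + q * M    ≡⟨ +-assoc (M′ ∸ X) X (q * M) ⟩
      (M′ ∸ X) + (X + q * M)  ≡⟨ cong ((M′ ∸ X) +_) (+-comm X (q * M)) ⟩
      (M′ ∸ X) + (q * M + X)  ≡⟨ +-assoc (M′ ∸ X) (q * M) X ⟨
      (M′ ∸ X) + q * M + X    ∎)

iter : ∀ {k} → (Fin k → Fin k) → ℕ → Fin k → Fin k
iter h zero    d = d
iter h (suc q) d = h (iter h q d)

iter-id : ∀ {k} q (d : Fin k) → iter (λ d → d) q d ≡ d
iter-id zero    d = refl
iter-id (suc q) d = iter-id q d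

iterFixed? : ∀ {k} (h : Fin k → Fin k) (c : ℕ) (d : Fin k) → Dec (iter h c d ≡ d)
iterFixed? h c d = iter h c d ≟ᶠ d

#fixed : ∀ {k} → (Fin k → Fin k) → ℕ → ℕ
#fixed {k} h c = #[ iterFixed? h c ] (allFin k)

module _ {M′ k : ℕ} where
  private
    M : ℕ
    M = suc M′

  ShiftEquivariant : ℕ → (Fin k → Fin k) → (Fin M → Fin k) → Set
  ShiftEquivariant s h v = ∀ y → v (shift s y) ≡ h (v y)

  shiftEquivariant? : ∀ s h v → Dec (ShiftEquivariant s h v)
  shiftEquivariant? s h v = all? (λ y → v (shift s y) ≟ᶠ h (v y))

#shiftEquivariant : ∀ {k} M′ → ℕ → (Fin k → Fin k) → ℕ
#shiftEquivariant {k} M′ s h = #[ shiftEquivariant? {M′} s h ] (allFuns (suc M′) (allFin k))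

module _ {M′ k : ℕ} (s : ℕ) (h : Fin k → Fin k) where

  shiftEquivariant-enumeration :
    Enumeration (TileVectors k (suc M′)) (λ v → ⊤ × ShiftEquivariant s h v) (filter (shiftEquivariant? s h) (allFuns (suc M′) (allFin k)))
  shiftEquivariant-enumeration = filter-enumeration (shiftEquivariant? s h)
    (λ v≋w v-eq y → trans (sym (v≋w _)) (trans (v-eq y) (cong h (v≋w y))))
    (allFuns-enumeration-⊤ (suc M′) (allFin-enumeration k))

-- Writing y = r + q g with r < g and q < c, an equivariant v is determined by its values at the
-- r < g, and these must be fixed by h^c.
module ShiftByDivisor {k : ℕ} (h : Fin k → Fin k) (g c M′ : ℕ) .{{_ : NonZero g}} (M≡c*g : suc M′ ≡ c * g) where
  private
    M : ℕ
    M = suc M′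

  c≢0 : c ≢ 0
  c≢0 c≡0 = 0≢1+n (sym (trans M≡c*g (cong (_* g) c≡0)))

  g≤M : g ≤ M
  g≤M = subst (g ≤_) (sym M≡c*g) (m≤n*m g c {{≢-nonZero c≢0}})

  <g⇒<M : ∀ {r} → r < g → r < M
  <g⇒<M r<g = <-≤-trans r<g g≤M

  quotient<c : ∀ Y → Y < M → Y / g < c
  quotient<c Y Y<M = m<n*o⇒m/o<n (subst (Y <_) M≡c*g Y<M)

  +g-decomposition : ∀ Y → Y + g ≡ Y % g + suc (Y / g) * g
  +g-decomposition Y = begin
    Y + g                       ≡⟨ cong (_+ g) (m≡m%n+[m/n]*n Y g) ⟩
    (Y % g + (Y / g) * g) + g   ≡⟨ +-assoc (Y % g) _ g ⟩
    Y % g + ((Y / g) * g + g)   ≡⟨ cong (Y % g +_) (+-comm _ g) ⟩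
    Y % g + suc (Y / g) * g     ∎

  toℕ-shift-g : ∀ (y : Fin M) → let Y = toℕ y in
    (suc (Y / g) < c × toℕ (shift g y) ≡ Y % g + suc (Y / g) * g) ⊎ (suc (Y / g) ≡ c × toℕ (shift g y) ≡ Y % g)
  toℕ-shift-g y with suc (toℕ y / g) <? c
  ... | yes 1+q<c = inj₁ (1+q<c , trans (toℕ-shift g y) (trans (m<n⇒m%n≡m Y+g<M) (+g-decomposition Y)))
    where
    Y : ℕ
    Y = toℕ y
    Y+g<M : Y + g < M
    Y+g<M = subst (_< M) (sym (+g-decomposition Y)) (subst (Y % g + suc (Y / g) * g <_) (sym M≡c*g)
      (<-≤-trans (+-monoˡ-< (suc (Y / g) * g) (m%n<n Y g)) (*-monoˡ-≤ g 1+q<c)))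
  ... | no 1+q≮c = inj₂ (1+q≡c , trans (toℕ-shift g y) (begin
    (Y + g) % M                   ≡⟨ %-congˡ (+g-decomposition Y) ⟩
    (Y % g + suc (Y / g) * g) % M ≡⟨ %-congˡ (cong (λ t → Y % g + t * g) 1+q≡c) ⟩
    (Y % g + c * g) % M           ≡⟨ %-congˡ (cong (Y % g +_) M≡c*g) ⟨
    (Y % g + M) % M               ≡⟨ [m+n]%n≡m%n (Y % g) M ⟩
    (Y % g) % M                   ≡⟨ m<n⇒m%n≡m (<g⇒<M (m%n<n Y g)) ⟩
    Y % g                         ∎))
    where
    Y : ℕ
    Y = toℕ y
    1+q≡c : suc (Y / g) ≡ c
    1+q≡c = ≤-antisym (quotient<c Y (toℕ<n y)) (≮⇒≥ 1+q≮c)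

  extend : (Fin g → Fin k) → Fin M → Fin k
  extend z y = iter h (toℕ y / g) (z (toℕ y mod g))

  extend-equivariant : ∀ z → (∀ i → iter h c (z i) ≡ z i) → ShiftEquivariant g h (extend z)
  extend-equivariant z z-fixed y with toℕ-shift-g y
  ... | inj₁ (_ , Y′≡) = cong₂ (λ q i → iter h q (z i))
          (trans (cong (_/ g) Y′≡) (r<n⇒[r+q*n]/n≡q (suc (Y / g)) (m%n<n Y g)))
          (toℕ-injective (trans (toℕ-mod (toℕ (shift g y)) g) (trans (cong (_% g) Y′≡)
            (trans (r<n⇒[r+q*n]%n≡r (suc (Y / g)) (m%n<n Y g)) (sym (toℕ-mod Y g))))))
    where
    Y : ℕ
    Y = toℕ y
  ... | inj₂ (1+q≡c , Y′≡) = begin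
    iter h (toℕ (shift g y) / g) (z (toℕ (shift g y) mod g))
      ≡⟨ cong₂ (λ q i → iter h q (z i)) (trans (cong (_/ g) Y′≡) (m<n⇒m/n≡0 (m%n<n Y g)))
               (toℕ-injective (trans (toℕ-mod (toℕ (shift g y)) g) (trans (cong (_% g) Y′≡) (trans (m%n%n≡m%n Y g) (sym (toℕ-mod Y g)))))) ⟩
    z (Y mod g)                  ≡⟨ z-fixed _ ⟨
    iter h c (z (Y mod g))       ≡⟨ cong (λ t → iter h t (z (Y mod g))) 1+q≡c ⟨
    h (extend z y)               ∎
    where
    Y : ℕ
    Y = toℕ y

  private
    at : ∀ n → n < M → Fin M
    at n n<M = fromℕ< n<M

    at-cong : ∀ {n n′} (p : n < M) (p′ : n′ < M) → n ≡ n′ → at n p ≡ at n′ p′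
    at-cong p p′ n≡n′ = toℕ-injective (trans (toℕ-fromℕ< p) (trans n≡n′ (sym (toℕ-fromℕ< p′))))

    shift-at : ∀ {a b} (a<M : a < M) (b<M : b < M) → (a + g) % M ≡ b → shift g (at a a<M) ≡ at b b<M
    shift-at {a} {b} a<M b<M a+g≡b = toℕ-injective (begin
      toℕ (shift g (at a a<M)) ≡⟨ toℕ-shift g (at a a<M) ⟩
      (toℕ (at a a<M) + g) % M ≡⟨ %-congˡ (cong (_+ g) (toℕ-fromℕ< a<M)) ⟩
      (a + g) % M              ≡⟨ a+g≡b ⟩
      b                        ≡⟨ toℕ-fromℕ< b<M ⟨
      toℕ (at b b<M)           ∎)

    embed : Fin g → Fin M
    embed i = at (toℕ i) (<g⇒<M (toℕ<n i))

  equivariant-iter : ∀ v → ShiftEquivariant g h v → ∀ q {r} (r<g : r < g) (p : r + q * g < M) →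
                     v (at _ p) ≡ iter h q (v (at r (<g⇒<M r<g)))
  equivariant-iter v v-eq zero    r<g p = cong v (at-cong p (<g⇒<M r<g) (+-identityʳ _))
  equivariant-iter v v-eq (suc q) {r} r<g p = begin
    v (at _ p)                        ≡⟨ cong v (shift-at p′ p (trans (%-congˡ next) (m<n⇒m%n≡m p))) ⟨
    v (shift g (at _ p′))             ≡⟨ v-eq (at _ p′) ⟩
    h (v (at _ p′))                   ≡⟨ cong h (equivariant-iter v v-eq q r<g p′) ⟩
    h (iter h q (v (at r (<g⇒<M r<g)))) ∎
    where
    p′ : r + q * g < M
    p′ = ≤-<-trans (+-monoʳ-≤ r (m≤n+m (q * g) g)) p
    next : r + q * g + g ≡ r + suc q * g
    next = trans (+-assoc r (q * g) g) (cong (r +_) (+-comm (q * g) g))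

  equivariant-fixed : ∀ v → ShiftEquivariant g h v → ∀ i → iter h c (v (embed i)) ≡ v (embed i)
  equivariant-fixed v v-eq i = sym (begin
    v (embed i)                        ≡⟨ cong v (shift-at last<M (<g⇒<M (toℕ<n i)) wraps) ⟨
    v (shift g (at _ last<M))          ≡⟨ v-eq _ ⟩
    h (v (at _ last<M))                ≡⟨ cong h (equivariant-iter v v-eq c′ (toℕ<n i) last<M) ⟩
    h (iter h c′ (v (embed i)))        ≡⟨ cong (λ t → iter h t (v (embed i))) c≡1+c′ ⟨
    iter h c (v (embed i))             ∎)
    where
    c′ : ℕ
    c′ = Data.Nat.pred c
    c≡1+c′ : c ≡ suc c′
    c≡1+c′ = sym (suc-pred c {{≢-nonZero c≢0}})
    r : ℕ
    r = toℕ i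
    last<M : r + c′ * g < M
    last<M = subst (λ t → r + c′ * g < t) (trans (cong (_* g) (sym c≡1+c′)) (sym M≡c*g)) (+-monoˡ-< (c′ * g) (toℕ<n i))
    wraps : (r + c′ * g + g) % M ≡ r
    wraps = begin
      (r + c′ * g + g) % M   ≡⟨ %-congˡ (+-assoc r (c′ * g) g) ⟩
      (r + (c′ * g + g)) % M ≡⟨ %-congˡ (cong (r +_) (trans (+-comm (c′ * g) g) (trans (cong (_* g) (sym c≡1+c′)) (sym M≡c*g)))) ⟩
      (r + M) % M            ≡⟨ [m+n]%n≡m%n r M ⟩
      r % M                  ≡⟨ m<n⇒m%n≡m (<g⇒<M (toℕ<n i)) ⟩
      r                      ∎

  extend-embed : ∀ z i → extend z (embed i) ≡ z i
  extend-embed z i = cong₂ (iter h)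
    (trans (cong (_/ g) (toℕ-fromℕ< (<g⇒<M (toℕ<n i)))) (m<n⇒m/n≡0 (toℕ<n i)))
    (cong z (toℕ-injective (trans (toℕ-mod (toℕ (embed i)) g) (trans (cong (_% g) (toℕ-fromℕ< (<g⇒<M (toℕ<n i)))) (m<n⇒m%n≡m (toℕ<n i))))))

  equivariant≡extend : ∀ v → ShiftEquivariant g h v → ∀ y → v y ≡ extend (λ i → v (embed i)) y
  equivariant≡extend v v-eq y = begin
    v y                                    ≡⟨ cong v (toℕ-injective (sym (trans (toℕ-fromℕ< p) (sym (m≡m%n+[m/n]*n Y g))))) ⟩
    v (at _ p)                             ≡⟨ equivariant-iter v v-eq (Y / g) (m%n<n Y g) p ⟩
    iter h (Y / g) (v (at (Y % g) (<g⇒<M (m%n<n Y g)))) ≡⟨ cong (λ t → iter h (Y / g) (v t)) (at-cong (<g⇒<M (m%n<n Y g)) (<g⇒<M (toℕ<n (Y mod g))) (sym (toℕ-mod Y g))) ⟩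
    extend (λ i → v (embed i)) y           ∎
    where
    Y : ℕ
    Y = toℕ y
    p : Y % g + (Y / g) * g < M
    p = subst (_< M) (m≡m%n+[m/n]*n Y g) (toℕ<n y)

  #shiftEquivariant≡#fixed^g : #shiftEquivariant M′ g h ≡ #fixed h c ^ g
  #shiftEquivariant≡#fixed^g = begin
    #shiftEquivariant M′ g h                        ≡⟨ enumeration-length (shiftEquivariant-enumeration g h) extensions ⟩
    length (map extend (allFuns g fixedTiles))      ≡⟨ length-map extend (allFuns g fixedTiles) ⟩
    length (allFuns g fixedTiles)                   ≡⟨ length-allFuns g fixedTiles ⟩
    #fixed h c ^ g                                  ∎
    where
    fixedTiles : List (Fin k)
    fixedTiles = filter (iterFixed? h c) (allFin k)
    extensions : Enumeration (TileVectors k M) (λ v → ⊤ × ShiftEquivariant g h v) (map extend (allFuns g fixedTiles))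
    extensions = map-enumeration extend
      (λ {z} {z′} z≋z′ y → cong (iter h (toℕ y / g)) (z≋z′ (toℕ y mod g)))
      (λ z z-fixed → tt , extend-equivariant z (λ i → proj₂ (z-fixed i)))
      (λ {z} {z′} _ _ ext≋ i → trans (sym (extend-embed z i)) (trans (ext≋ (embed i)) (extend-embed z′ i)))
      (λ v (_ , v-eq) → (λ i → v (embed i)) , (λ i → tt , equivariant-fixed v v-eq i) , equivariant≡extend v v-eq)
      (allFuns-enumeration g (filter-enumeration (iterFixed? h c) (λ { refl fixed → fixed }) (allFin-enumeration k)))

  -- As gcd (c , u) = 1, relabel is a bijection of ℤ/M conjugating the shift by g into the shift by s.
  module Relabel (s u : ℕ) (s≡u*g : s ≡ u * g) (coprime : Coprime c u) where

    relabel : Fin M → Fin M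
    relabel y = (toℕ y % g + (toℕ y / g) * s) mod M

    private
      g∣M : g ∣ M
      g∣M = divides c M≡c*g

      c*s≡u*M : c * s ≡ u * M
      c*s≡u*M = begin
        c * s        ≡⟨ cong (c *_) s≡u*g ⟩
        c * (u * g)  ≡⟨ *-assoc c u g ⟨
        (c * u) * g  ≡⟨ cong (_* g) (*-comm c u) ⟩
        (u * c) * g  ≡⟨ *-assoc u c g ⟩
        u * (c * g)  ≡⟨ cong (u *_) M≡c*g ⟨
        u * M        ∎

      [r+q*s]%M%g≡r : ∀ {r} q → r < g → ((r + q * s) % M) % g ≡ r
      [r+q*s]%M%g≡r {r} q r<g = trans (m∣n⇒o%n%m≡o%m g M (r + q * s) g∣M)
        (trans (%-remove-+ʳ r (divides (q * u) (trans (cong (q *_) s≡u*g) (sym (*-assoc q u g))))) (m<n⇒m%n≡m r<g))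

      q-injective : ∀ r {q q′} → q ≤ q′ → q′ < c → (r + q * s) % M ≡ (r + q′ * s) % M → q ≡ q′
      q-injective r {q} {q′} q≤q′ q′<c eq = ∣∸∧<⇒≡ q≤q′ (≤-<-trans (m∸n≤m q′ q) q′<c)
        (coprime-divisor coprime (subst (c ∣_) (*-comm (q′ ∸ q) u) c∣[q′∸q]*u))
        where
        M∣[q′∸q]*s : M ∣ (q′ ∸ q) * s
        M∣[q′∸q]*s = subst (M ∣_) (trans ([m+n]∸[m+o]≡n∸o r (q′ * s) (q * s)) (sym (*-distribʳ-∸ s q′ q)))
                       (%-≡⇒∣∸ (r + q * s) (r + q′ * s) eq)
        c∣[q′∸q]*u : c ∣ (q′ ∸ q) * u
        c∣[q′∸q]*u = *-cancelʳ-∣ g (subst₂ _∣_ M≡c*g (trans (cong ((q′ ∸ q) *_) s≡u*g) (sym (*-assoc (q′ ∸ q) u g))) M∣[q′∸q]*s)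

    relabel-shift : ∀ y → relabel (shift g y) ≡ shift s (relabel y)
    relabel-shift y = toℕ-injective (begin
      toℕ (relabel (shift g y))          ≡⟨ toℕ-mod (Y′ % g + (Y′ / g) * s) M ⟩
      (Y′ % g + (Y′ / g) * s) % M        ≡⟨ shifted ⟩
      (Y % g + suc (Y / g) * s) % M      ≡⟨ %-congˡ (trans (cong (Y % g +_) (+-comm s _)) (sym (+-assoc (Y % g) _ s))) ⟩
      (Y % g + (Y / g) * s + s) % M      ≡⟨ [m%n+o]%n≡[m+o]%n (Y % g + (Y / g) * s) s ⟨
      ((Y % g + (Y / g) * s) % M + s) % M ≡⟨ %-congˡ (cong (_+ s) (toℕ-mod (Y % g + (Y / g) * s) M)) ⟨
      (toℕ (relabel y) + s) % M          ≡⟨ toℕ-shift s (relabel y) ⟨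
      toℕ (shift s (relabel y))          ∎)
      where
      Y : ℕ
      Y = toℕ y
      Y′ : ℕ
      Y′ = toℕ (shift g y)
      shifted : (Y′ % g + (Y′ / g) * s) % M ≡ (Y % g + suc (Y / g) * s) % M
      shifted with toℕ-shift-g y
      ... | inj₁ (_ , Y′≡) = cong₂ (λ r q → (r + q * s) % M)
              (trans (cong (_% g) Y′≡) (r<n⇒[r+q*n]%n≡r (suc (Y / g)) (m%n<n Y g)))
              (trans (cong (_/ g) Y′≡) (r<n⇒[r+q*n]/n≡q (suc (Y / g)) (m%n<n Y g)))
      ... | inj₂ (1+q≡c , Y′≡) = begin
        (Y′ % g + (Y′ / g) * s) % M    ≡⟨ cong₂ (λ r q → (r + q * s) % M) (trans (cong (_% g) Y′≡) (m%n%n≡m%n Y g))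
                                                                         (trans (cong (_/ g) Y′≡) (m<n⇒m/n≡0 (m%n<n Y g))) ⟩
        (Y % g + 0) % M                ≡⟨ %-congˡ (+-identityʳ (Y % g)) ⟩
        (Y % g) % M                    ≡⟨ [m+kn]%n≡m%n (Y % g) u M ⟨
        (Y % g + u * M) % M            ≡⟨ %-congˡ (cong (Y % g +_) c*s≡u*M) ⟨
        (Y % g + c * s) % M            ≡⟨ %-congˡ (cong (λ t → Y % g + t * s) 1+q≡c) ⟨
        (Y % g + suc (Y / g) * s) % M  ∎

    relabel-injective : ∀ {y y′} → relabel y ≡ relabel y′ → y ≡ y′
    relabel-injective {y} {y′} eq = toℕ-injective (begin
      Y                       ≡⟨ m≡m%n+[m/n]*n Y g ⟩
      Y % g + (Y / g) * g     ≡⟨ cong₂ (λ r q → r + q * g) r≡r′ q≡q′ ⟩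
      Y′ % g + (Y′ / g) * g   ≡⟨ m≡m%n+[m/n]*n Y′ g ⟨
      Y′                      ∎)
      where
      Y : ℕ
      Y = toℕ y
      Y′ : ℕ
      Y′ = toℕ y′
      eq% : (Y % g + (Y / g) * s) % M ≡ (Y′ % g + (Y′ / g) * s) % M
      eq% = trans (sym (toℕ-mod (Y % g + (Y / g) * s) M)) (trans (cong toℕ eq) (toℕ-mod (Y′ % g + (Y′ / g) * s) M))
      r≡r′ : Y % g ≡ Y′ % g
      r≡r′ = trans (sym ([r+q*s]%M%g≡r (Y / g) (m%n<n Y g))) (trans (cong (_% g) eq%) ([r+q*s]%M%g≡r (Y′ / g) (m%n<n Y′ g)))
      eq%′ : (Y % g + (Y / g) * s) % M ≡ (Y % g + (Y′ / g) * s) % M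
      eq%′ = trans eq% (cong (λ r → (r + (Y′ / g) * s) % M) (sym r≡r′))
      q≡q′ : Y / g ≡ Y′ / g
      q≡q′ with ≤-total (Y / g) (Y′ / g)
      ... | inj₁ q≤q′ = q-injective (Y % g) q≤q′ (quotient<c Y′ (toℕ<n y′)) eq%′
      ... | inj₂ q′≤q = sym (q-injective (Y % g) q′≤q (quotient<c Y (toℕ<n y)) (sym eq%′))

    open InjectiveEndo relabel relabel-injective

    #shiftEquivariant-relabel : #shiftEquivariant M′ s h ≡ #shiftEquivariant M′ g h
    #shiftEquivariant-relabel = begin
      #shiftEquivariant M′ s h               ≡⟨ length-map pullback equivariant ⟨
      length (map pullback equivariant)      ≡⟨ enumeration-length pullbacks (shiftEquivariant-enumeration g h) ⟩
      #shiftEquivariant M′ g h               ∎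
      where
      equivariant : List (Fin M → Fin k)
      equivariant = filter (shiftEquivariant? s h) (allFuns M (allFin k))
      pullback : (Fin M → Fin k) → Fin M → Fin k
      pullback v y = v (relabel y)
      f⁻¹-shift : ∀ y → f⁻¹ (shift s y) ≡ shift g (f⁻¹ y)
      f⁻¹-shift y = trans (cong (λ t → f⁻¹ (shift s t)) (sym (f∘f⁻¹ y))) (trans (cong f⁻¹ (sym (relabel-shift (f⁻¹ y)))) (f⁻¹∘f _))
      pullbacks : Enumeration (TileVectors k M) (λ v → ⊤ × ShiftEquivariant g h v) (map pullback equivariant)
      pullbacks = map-enumeration pullback
        (λ v≋w y → v≋w (relabel y))
        (λ v (_ , v-eq) → tt , λ y → trans (cong v (relabel-shift y)) (v-eq (relabel y)))
        (λ {v} {w} _ _ v∘f≋w∘f y → trans (cong v (sym (f∘f⁻¹ y))) (trans (v∘f≋w∘f (f⁻¹ y)) (cong w (f∘f⁻¹ y))))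
        (λ w (_ , w-eq) → (λ y → w (f⁻¹ y)) , (tt , λ y → trans (cong w (f⁻¹-shift y)) (w-eq (f⁻¹ y))) , λ y → cong w (sym (f⁻¹∘f y)))
        (shiftEquivariant-enumeration s h)

div≡/ : ∀ m n .{{_ : NonZero n}} → m div n ≡ m / n
div≡/ m (suc n) = refl

#shiftEquivariant≡#fixed^gcd : ∀ {k} M′ (h : Fin k → Fin k) s →
  #shiftEquivariant M′ s h ≡ #fixed h (suc M′ div gcd s (suc M′)) ^ gcd s (suc M′)
#shiftEquivariant≡#fixed^gcd M′ h s = begin
  #shiftEquivariant M′ s h    ≡⟨ #shiftEquivariant-relabel ⟩
  #shiftEquivariant M′ g h    ≡⟨ #shiftEquivariant≡#fixed^g ⟩
  #fixed h (M / g) ^ g        ≡⟨ cong (λ c → #fixed h c ^ g) (div≡/ M g) ⟨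
  #fixed h (M div g) ^ g      ∎
  where
  M : ℕ
  M = suc M′
  g : ℕ
  g = gcd s M
  instance
    g≢0 : NonZero g
    g≢0 = ≢-nonZero (gcd[m,n]≢0 s M (inj₂ λ ()))
  open ShiftByDivisor h g (M / g) M′ (sym (m/n*n≡m (gcd[m,n]∣n s M)))
  open Relabel s (s / g) (sym (m/n*n≡m (gcd[m,n]∣m s M))) (Coprime.sym (coprime-/gcd s M))

module _ {n : ℕ} (σ : Fin n → Fin n) where

  isFixedPoint? : ∀ x → Dec (σ x ≡ x)
  isFixedPoint? x = σ x ≟ᶠ x

  isLeader? : ∀ x → Dec (x <ᶠ σ x)
  isLeader? x = x <ᶠ? σ x

  isFollower? : ∀ x → Dec (σ x <ᶠ x)
  isFollower? x = σ x <ᶠ? x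

  #fixedPoints #leaders #followers : ℕ
  #fixedPoints = #[ isFixedPoint? ] (allFin n)
  #leaders     = #[ isLeader? ] (allFin n)
  #followers   = #[ isFollower? ] (allFin n)

  private
    partition : ∀ xs → #[ isFixedPoint? ] xs + (#[ isLeader? ] xs + #[ isFollower? ] xs) ≡ length xs
    partition [] = refl
    partition (x ∷ xs) with <-cmp (toℕ x) (toℕ (σ x))
    ... | tri< x<σx x≢σx _ = begin
      _ ≡⟨ cong₂ _+_ (#-reject isFixedPoint? xs (λ eq → x≢σx (cong toℕ (sym eq))))
                     (cong₂ _+_ (#-accept isLeader? xs x<σx) (#-reject isFollower? xs (<ᶠ-asym x<σx))) ⟩
      _ ≡⟨ +-suc _ _ ⟩
      _ ≡⟨ cong suc (partition xs) ⟩
      _ ∎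
    ... | tri≈ _ x≡σx _ = begin
      _ ≡⟨ cong₂ _+_ (#-accept isFixedPoint? xs (toℕ-injective (sym x≡σx)))
                     (cong₂ _+_ (#-reject isLeader? xs (<-irrefl x≡σx)) (#-reject isFollower? xs (<-irrefl (sym x≡σx)))) ⟩
      _ ≡⟨ cong suc (partition xs) ⟩
      _ ∎
    ... | tri> _ x≢σx σx<x = begin
      _ ≡⟨ cong₂ _+_ (#-reject isFixedPoint? xs (λ eq → x≢σx (cong toℕ (sym eq))))
                     (cong₂ _+_ (#-reject isLeader? xs (<ᶠ-asym σx<x)) (#-accept isFollower? xs σx<x)) ⟩
      _ ≡⟨ cong (#[ isFixedPoint? ] xs +_) (+-suc _ _) ⟩
      _ ≡⟨ +-suc _ _ ⟩
      _ ≡⟨ cong suc (partition xs) ⟩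
      _ ∎

  #fixedPoints+#leaders+#followers : #fixedPoints + (#leaders + #followers) ≡ n
  #fixedPoints+#leaders+#followers = trans (partition (allFin n)) (length-tabulate (λ i → i))

  module _ (σ-involutive : ∀ x → σ (σ x) ≡ x) where

    #leaders≡#followers : #leaders ≡ #followers
    #leaders≡#followers = begin
      #leaders                                  ≡⟨ enumeration-length leaders (map-enumeration σ (cong σ) follower⇒leader
                                                      (λ {x} {y} _ _ σx≡σy → trans (sym (σ-involutive x)) (trans (cong σ σx≡σy) (σ-involutive y)))
                                                      (λ y (_ , y<σy) → σ y , (tt , subst (_<ᶠ σ y) (sym (σ-involutive y)) y<σy) , sym (σ-involutive y))
                                                      followers) ⟩
      length (map σ (filter isFollower? (allFin n))) ≡⟨ length-map σ (filter isFollower? (allFin n)) ⟩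
      #followers                                ∎
      where
      leaders : Enumeration (≡.setoid (Fin n)) (λ x → ⊤ × x <ᶠ σ x) (filter isLeader? (allFin n))
      leaders = filter-enumeration isLeader? (λ { refl lt → lt }) (allFin-enumeration n)
      followers : Enumeration (≡.setoid (Fin n)) (λ x → ⊤ × σ x <ᶠ x) (filter isFollower? (allFin n))
      followers = filter-enumeration isFollower? (λ { refl lt → lt }) (allFin-enumeration n)
      follower⇒leader : ∀ x → ⊤ × σ x <ᶠ x → ⊤ × σ x <ᶠ σ (σ x)
      follower⇒leader x (_ , σx<x) = tt , subst (σ x <ᶠ_) (sym (σ-involutive x)) σx<x

    #fixedPoints+2*#leaders : #fixedPoints + (#leaders + #leaders) ≡ n
    #fixedPoints+2*#leaders = trans (cong (λ t → #fixedPoints + (#leaders + t)) #leaders≡#followers) #fixedPoints+#leaders+#followers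

-- A follower x (σ x < x) is determined by its leader σ x, so its only choice is an arbitrary value v₀.
module EquivariantUnderInvolution
  {S : Setoid 0ℓ 0ℓ} (_≈?_ : ∀ v w → Dec (Setoid._≈_ S v w))
  (values : List (Setoid.Carrier S)) (values-enumeration : Enumeration S (λ _ → ⊤) values)
  (L : Setoid.Carrier S → Setoid.Carrier S) (L-cong : ∀ {v w} → Setoid._≈_ S v w → Setoid._≈_ S (L v) (L w))
  (v₀ : Setoid.Carrier S)
  {n : ℕ} (σ : Fin n → Fin n) (σ-involutive : ∀ x → σ (σ x) ≡ x) where

  open Setoid S renaming (Carrier to V; refl to ≈-refl; sym to ≈-sym; trans to ≈-trans; reflexive to ≈-reflexive)

  Equivariant : (Fin n → V) → Set
  Equivariant τ = ∀ x → τ (σ x) ≈ L (τ x)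

  equivariant? : ∀ τ → Dec (Equivariant τ)
  equivariant? τ = all? (λ x → τ (σ x) ≈? L (τ x))

  L-fixed? : ∀ v → Dec (v ≈ L v)
  L-fixed? v = v ≈? L v

  L²-fixed? : ∀ v → Dec (v ≈ L (L v))
  L²-fixed? v = v ≈? L (L v)

  fixedPoint? : ∀ x → Dec (σ x ≡ x)
  fixedPoint? = isFixedPoint? σ

  leader? : ∀ x → Dec (x <ᶠ σ x)
  leader? = isLeader? σ

  data View (x : Fin n) : Set where
    fixedPoint : σ x ≡ x → View x
    leader     : x <ᶠ σ x → View x
    follower   : σ x <ᶠ x → View x

  view : ∀ x → View x
  view x with σ x ≟ᶠ x
  ... | yes σx≡x = fixedPoint σx≡x
  ... | no σx≢x with x <ᶠ? σ x
  ... | yes x<σx = leader x<σx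
  ... | no x≮σx  = follower (≤∧≢⇒< (≮⇒≥ x≮σx) (λ σx≡x → σx≢x (toℕ-injective σx≡x)))

  view-partner-of-leader : ∀ {x} → x <ᶠ σ x → (w : View (σ x)) → Σ (σ (σ x) <ᶠ σ x) (λ lt → w ≡ follower lt)
  view-partner-of-leader {x} x<σx (fixedPoint eq) = ⊥-elim (<ᶠ-irrefl (trans (sym (σ-involutive x)) eq) x<σx)
  view-partner-of-leader {x} x<σx (leader lt)     = ⊥-elim (<ᶠ-asym x<σx (subst (σ x <ᶠ_) (σ-involutive x) lt))
  view-partner-of-leader {x} x<σx (follower lt)   = lt , refl

  view-partner-of-follower : ∀ {x} → σ x <ᶠ x → (w : View (σ x)) → Σ (σ x <ᶠ σ (σ x)) (λ lt → w ≡ leader lt)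
  view-partner-of-follower {x} σx<x (fixedPoint eq) = ⊥-elim (<ᶠ-irrefl (trans (sym eq) (σ-involutive x)) σx<x)
  view-partner-of-follower {x} σx<x (leader lt)     = lt , refl
  view-partner-of-follower {x} σx<x (follower lt)   = ⊥-elim (<ᶠ-asym σx<x (subst (_<ᶠ σ x) (σ-involutive x) lt))

  Admissible′ : ∀ x → View x → V → Set
  Admissible′ x (fixedPoint _) v = ⊤ × v ≈ L v
  Admissible′ x (leader _)     v = ⊤ × v ≈ L (L v)
  Admissible′ x (follower _)   v = v ≈ v₀

  choices′ : ∀ x → View x → List V
  choices′ x (fixedPoint _) = filter L-fixed? values
  choices′ x (leader _)     = filter L²-fixed? values
  choices′ x (follower _)   = v₀ ∷ []

  choices′-enumeration : ∀ x (w : View x) → Enumeration S (Admissible′ x w) (choices′ x w)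
  choices′-enumeration x (fixedPoint _) =
    filter-enumeration L-fixed? (λ v≈w v≈Lv → ≈-trans (≈-sym v≈w) (≈-trans v≈Lv (L-cong v≈w))) values-enumeration
  choices′-enumeration x (leader _) =
    filter-enumeration L²-fixed? (λ v≈w v≈LLv → ≈-trans (≈-sym v≈w) (≈-trans v≈LLv (L-cong (L-cong v≈w)))) values-enumeration
  choices′-enumeration x (follower _) = mkEnumeration (≈-refl ∷ []) ([] ∷ []) (λ _ v≈v₀ → here v≈v₀)

  Admissible : Fin n → V → Set
  Admissible x = Admissible′ x (view x)

  choices : Fin n → List V
  choices x = choices′ x (view x)

  assemble′ : (Fin n → V) → ∀ x → View x → V
  assemble′ z x (follower _) = L (z (σ x))
  assemble′ z x _            = z x

  assemble : (Fin n → V) → Fin n → V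
  assemble z x = assemble′ z x (view x)

  assemble-equivariant : ∀ z → (∀ x → Admissible x (z x)) → Equivariant (assemble z)
  assemble-equivariant z adm x with view x | adm x
  ... | fixedPoint σx≡x | (_ , zx≈Lzx) = subst (λ t → assemble z t ≈ L (z x)) (sym σx≡x) (at-fixed (view x) refl)
    where
    at-fixed : ∀ w → view x ≡ w → assemble z x ≈ L (z x)
    at-fixed (fixedPoint _) eq = subst (λ w → assemble′ z x w ≈ L (z x)) (sym eq) zx≈Lzx
    at-fixed (leader _)     eq = subst (λ w → assemble′ z x w ≈ L (z x)) (sym eq) zx≈Lzx
    at-fixed (follower lt)  _  = ⊥-elim (<ᶠ-irrefl σx≡x lt)
  ... | leader x<σx | _ with view-partner-of-leader x<σx (view (σ x))
  ... | _ , eq = subst (λ w → assemble′ z (σ x) w ≈ L (z x)) (sym eq) (L-cong (≈-reflexive (cong z (σ-involutive x))))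
  assemble-equivariant z adm x | follower σx<x | _ with view-partner-of-follower σx<x (view (σ x)) | adm (σ x)
  ... | lt , eq | adm-σx = subst (λ w → assemble′ z (σ x) w ≈ L (L (z (σ x)))) (sym eq) (at-leader (view (σ x)) eq adm-σx)
    where
    at-leader : ∀ w → w ≡ leader lt → Admissible′ (σ x) w (z (σ x)) → z (σ x) ≈ L (L (z (σ x)))
    at-leader _ refl (_ , zσx≈LLzσx) = zσx≈LLzσx

  assemble-cong : ∀ {z z′} → (∀ x → z x ≈ z′ x) → ∀ x → assemble z x ≈ assemble z′ x
  assemble-cong z≈z′ x with view x
  ... | fixedPoint _ = z≈z′ x
  ... | leader _     = z≈z′ x
  ... | follower _   = L-cong (z≈z′ (σ x))

  assemble-injective : ∀ {z z′} → (∀ x → Admissible x (z x)) → (∀ x → Admissible x (z′ x)) →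
                       (∀ x → assemble z x ≈ assemble z′ x) → ∀ x → z x ≈ z′ x
  assemble-injective adm adm′ eq x with view x | adm x | adm′ x | eq x
  ... | fixedPoint _ | _       | _        | eqx = eqx
  ... | leader _     | _       | _        | eqx = eqx
  ... | follower _   | zx≈v₀ | z′x≈v₀ | _   = ≈-trans zx≈v₀ (≈-sym z′x≈v₀)

  restrict′ : (Fin n → V) → ∀ x → View x → V
  restrict′ τ x (follower _) = v₀
  restrict′ τ x _            = τ x

  restrict : (Fin n → V) → Fin n → V
  restrict τ x = restrict′ τ x (view x)

  restrict-leader : ∀ τ {y} → y <ᶠ σ y → restrict τ y ≡ τ y
  restrict-leader τ {y} y<σy with view y
  ... | fixedPoint eq = ⊥-elim (<ᶠ-irrefl (sym eq) y<σy)
  ... | leader _      = refl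
  ... | follower lt   = ⊥-elim (<ᶠ-asym y<σy lt)

  restrict-admissible : ∀ τ → Equivariant τ → ∀ x → Admissible x (restrict τ x)
  restrict-admissible τ τ-eq x with view x
  ... | fixedPoint eq = tt , subst (λ t → τ t ≈ L (τ x)) eq (τ-eq x)
  ... | leader _      = tt , ≈-trans (subst (λ t → τ t ≈ L (τ (σ x))) (σ-involutive x) (τ-eq (σ x))) (L-cong (τ-eq x))
  ... | follower _    = ≈-refl

  equivariant≈assemble : ∀ τ → Equivariant τ → ∀ x → τ x ≈ assemble (restrict τ) x
  equivariant≈assemble τ τ-eq x = go (view x) refl
    where
    go : (w : View x) → view x ≡ w → τ x ≈ assemble (restrict τ) x
    go (fixedPoint _) eq = subst (λ w → τ x ≈ assemble′ (restrict τ) x w) (sym eq) (≈-reflexive (sym (cong (restrict′ τ x) eq)))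
    go (leader _)     eq = subst (λ w → τ x ≈ assemble′ (restrict τ) x w) (sym eq) (≈-reflexive (sym (cong (restrict′ τ x) eq)))
    go (follower lt)  eq = subst (λ w → τ x ≈ assemble′ (restrict τ) x w) (sym eq)
      (≈-trans (subst (λ t → τ t ≈ L (τ (σ x))) (σ-involutive x) (τ-eq (σ x)))
               (L-cong (≈-reflexive (sym (restrict-leader τ (subst (σ x <ᶠ_) (sym (σ-involutive x)) lt))))))

  #L-fixed : ℕ
  #L-fixed = #[ L-fixed? ] values
  #L²-fixed : ℕ
  #L²-fixed = #[ L²-fixed? ] values

  product-choices : ∀ xs → product (map (λ x → length (choices x)) xs) ≡ #L-fixed ^ #[ fixedPoint? ] xs * #L²-fixed ^ #[ leader? ] xs
  product-choices [] = refl
  product-choices (x ∷ xs) with view x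
  ... | fixedPoint eq = begin
    A * _                   ≡⟨ cong (A *_) (product-choices xs) ⟩
    A * (A ^ f * B ^ l)     ≡⟨ *-assoc A _ _ ⟨
    A ^ suc f * B ^ l       ≡⟨ cong₂ (λ i j → A ^ i * B ^ j) (#-accept fixedPoint? xs eq) (#-reject leader? xs (<ᶠ-irrefl (sym eq))) ⟨
    A ^ #[ fixedPoint? ] (x ∷ xs) * B ^ #[ leader? ] (x ∷ xs) ∎
    where
    A B f l : ℕ
    A = #L-fixed
    B = #L²-fixed
    f = #[ fixedPoint? ] xs
    l = #[ leader? ] xs
  ... | leader lt = begin
    B * _                   ≡⟨ cong (B *_) (product-choices xs) ⟩
    B * (A ^ f * B ^ l)     ≡⟨ x*[y*z]≡y*[x*z] B (A ^ f) (B ^ l) ⟩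
    A ^ f * B ^ suc l       ≡⟨ cong₂ (λ i j → A ^ i * B ^ j) (#-reject fixedPoint? xs (λ eq → <ᶠ-irrefl (sym eq) lt)) (#-accept leader? xs lt) ⟨
    A ^ #[ fixedPoint? ] (x ∷ xs) * B ^ #[ leader? ] (x ∷ xs) ∎
    where
    A B f l : ℕ
    A = #L-fixed
    B = #L²-fixed
    f = #[ fixedPoint? ] xs
    l = #[ leader? ] xs
  ... | follower lt = trans (+-identityʳ _) (trans (product-choices xs)
    (sym (cong₂ (λ i j → #L-fixed ^ i * #L²-fixed ^ j) (#-reject fixedPoint? xs (λ eq → <ᶠ-irrefl eq lt)) (#-reject leader? xs (<ᶠ-asym lt)))))

  #equivariant : #[ equivariant? ] (allFuns n values) ≡ #L-fixed ^ #fixedPoints σ * #L²-fixed ^ #leaders σ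
  #equivariant = begin
    #[ equivariant? ] (allFuns n values)                      ≡⟨ enumeration-length equivariants assembled ⟩
    length (map assemble (allFunsWith n choices))              ≡⟨ length-map assemble (allFunsWith n choices) ⟩
    length (allFunsWith n choices)                             ≡⟨ length-allFunsWith n choices ⟩
    product (map (λ x → length (choices x)) (allFin n))        ≡⟨ product-choices (allFin n) ⟩
    #L-fixed ^ #fixedPoints σ * #L²-fixed ^ #leaders σ     ∎
    where
    equivariants : Enumeration (Vectors S n) (λ τ → ⊤ × Equivariant τ) (filter equivariant? (allFuns n values))
    equivariants = filter-enumeration equivariant? (λ τ≋τ′ τ-eq x → ≈-trans (≈-sym (τ≋τ′ (σ x))) (≈-trans (τ-eq x) (L-cong (τ≋τ′ x))))
                     (allFuns-enumeration-⊤ n values-enumeration)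
    assembled : Enumeration (Vectors S n) (λ τ → ⊤ × Equivariant τ) (map assemble (allFunsWith n choices))
    assembled = map-enumeration assemble (λ z≋z′ → assemble-cong z≋z′)
      (λ z adm → tt , assemble-equivariant z adm) assemble-injective
      (λ τ (_ , τ-eq) → restrict τ , restrict-admissible τ τ-eq , equivariant≈assemble τ τ-eq)
      (allFunsWith-enumeration n Admissible choices (λ x → choices′-enumeration x (view x)))

#fixed-id : ∀ k c → #fixed {k} (λ d → d) c ≡ k
#fixed-id k c = trans (#-all (iterFixed? (λ d → d) c) {allFin k} (All.tabulate λ {d} _ → iter-id c d)) (length-tabulate (λ i → i))

module _ {N′ M′ k : ℕ} where
  private
    N : ℕ
    N = suc N′
    M : ℕ
    M = suc M′

  GlideFixed : Fin N → Fin M → (Fin k → Fin k) → (Fin N → Fin M → Fin k) → Set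
  GlideFixed a b h τ = ∀ x y → τ (reflect a x) (shift (toℕ b) y) ≡ h (τ x y)

  glideFixed? : ∀ a b h τ → Dec (GlideFixed a b h τ)
  glideFixed? a b h τ = all? (λ x → all? (λ y → τ (reflect a x) (shift (toℕ b) y) ≟ᶠ h (τ x y)))

  #glideFixed : Fin N → Fin M → (Fin k → Fin k) → ℕ
  #glideFixed a b h = #[ glideFixed? a b h ] (allFuns N (allFuns M (allFin k)))

module GlideReflection {N′ M′ k′ : ℕ} (a : Fin (suc N′)) (b : Fin (suc M′))
                       (h : Fin (suc k′) → Fin (suc k′)) (h-involutive : ∀ d → h (h d) ≡ d) where
  private
    N : ℕ
    N = suc N′
    M : ℕ
    M = suc M′
    k : ℕ
    k = suc k′
    B : ℕ
    B = toℕ b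

  open InjectiveEndo (shift {M′} B) (shift-injective {M′} B)
    renaming (f⁻¹ to unshift; f∘f⁻¹ to shift∘unshift; f⁻¹∘f to unshift∘shift)

  L : (Fin M → Fin k) → Fin M → Fin k
  L v y = h (v (unshift y))

  open EquivariantUnderInvolution {TileVectors k M} (λ v w → all? (λ y → v y ≟ᶠ w y))
    (allFuns M (allFin k)) (allFuns-enumeration-⊤ M (allFin-enumeration k))
    L (λ {v} {w} v≋w y → cong h (v≋w (unshift y))) (λ _ → zero) (reflect a) (reflect-involutive a)

  #glideFixed≡#equivariant : #glideFixed a b h ≡ #[ equivariant? ] (allFuns N (allFuns M (allFin k)))
  #glideFixed≡#equivariant = #-cong (glideFixed? a b h) equivariant?
    (λ {τ} τ-fixed x y → trans (cong (τ (reflect a x)) (sym (shift∘unshift y))) (τ-fixed x (unshift y)))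
    (λ {τ} τ-eq x y → trans (τ-eq x (shift B y)) (cong (λ t → h (τ x t)) (unshift∘shift y)))
    (allFuns N (allFuns M (allFin k)))

  #L-fixed≡ : #L-fixed ≡ #fixed h (M div gcd B M) ^ gcd B M
  #L-fixed≡ = trans (#-cong L-fixed? (shiftEquivariant? B h)
    (λ {v} v≋Lv y → trans (v≋Lv (shift B y)) (cong (λ t → h (v t)) (unshift∘shift y)))
    (λ {v} v-eq y → trans (cong v (sym (shift∘unshift y))) (v-eq (unshift y)))
    (allFuns M (allFin k))) (#shiftEquivariant≡#fixed^gcd M′ h B)

  #L²-fixed≡ : #L²-fixed ≡ k ^ gcd (B + B) M
  #L²-fixed≡ = begin
    #L²-fixed                                         ≡⟨ #-cong L²-fixed? (shiftEquivariant? (B + B) idᵏ)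
                                                           L²-fixed⇒periodic periodic⇒L²-fixed (allFuns M (allFin k)) ⟩
    #shiftEquivariant M′ (B + B) idᵏ                  ≡⟨ #shiftEquivariant≡#fixed^gcd M′ idᵏ (B + B) ⟩
    #fixed idᵏ (M div gcd (B + B) M) ^ gcd (B + B) M  ≡⟨ cong (_^ gcd (B + B) M) (#fixed-id k (M div gcd (B + B) M)) ⟩
    k ^ gcd (B + B) M                                 ∎
    where
    idᵏ : Fin k → Fin k
    idᵏ d = d
    unshift² : ∀ y → unshift (unshift (shift B (shift B y))) ≡ y
    unshift² y = trans (cong unshift (unshift∘shift (shift B y))) (unshift∘shift y)
    L²-fixed⇒periodic : ∀ {v} → (∀ y → v y ≡ L (L v) y) → ShiftEquivariant (B + B) idᵏ v
    L²-fixed⇒periodic {v} v≋LLv y = trans (cong v (sym (shift∘shift B B y)))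
      (trans (v≋LLv (shift B (shift B y))) (trans (h-involutive _) (cong v (unshift² y))))
    periodic⇒L²-fixed : ∀ {v} → ShiftEquivariant (B + B) idᵏ v → ∀ y → v y ≡ L (L v) y
    periodic⇒L²-fixed {v} v-per y = begin
      v y                                    ≡⟨ cong v (trans (cong (shift B) (shift∘unshift (unshift y))) (shift∘unshift y)) ⟨
      v (shift B (shift B (unshift (unshift y)))) ≡⟨ cong v (shift∘shift B B (unshift (unshift y))) ⟩
      v (shift (B + B) (unshift (unshift y)))    ≡⟨ v-per _ ⟩
      v (unshift (unshift y))                    ≡⟨ h-involutive _ ⟨
      L (L v) y                                  ∎

  #glideFixed≡ : #glideFixed a b h ≡
    (#fixed h (M div gcd B M) ^ gcd B M) ^ #fixedPoints (reflect a) * (k ^ gcd (B + B) M) ^ #leaders (reflect a)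
  #glideFixed≡ = begin
    #glideFixed a b h                                       ≡⟨ #glideFixed≡#equivariant ⟩
    #[ equivariant? ] (allFuns N (allFuns M (allFin k)))    ≡⟨ #equivariant ⟩
    #L-fixed ^ #fixedPoints (reflect a) * #L²-fixed ^ #leaders (reflect a)
      ≡⟨ cong₂ (λ p q → p ^ #fixedPoints (reflect a) * q ^ #leaders (reflect a)) #L-fixed≡ #L²-fixed≡ ⟩
    (#fixed h (M div gcd B M) ^ gcd B M) ^ #fixedPoints (reflect a) * (k ^ gcd (B + B) M) ^ #leaders (reflect a) ∎

parity : ∀ n → (∃ λ j → n ≡ j * 2) ⊎ (∃ λ j → n ≡ 1 + j * 2)
parity n with n % 2 | m%n<n n 2 | m≡m%n+[m/n]*n n 2
... | 0 | _ | n≡ = inj₁ (n / 2 , n≡)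
... | 1 | _ | n≡ = inj₂ (n / 2 , n≡)
... | suc (suc _) | s≤s (s≤s ()) | _

*2≢1+*2 : ∀ i j → i * 2 ≢ 1 + j * 2
*2≢1+*2 i j eq = even≢odd i j (subst₂ (λ u v → u ≡ suc v) (*-comm i 2) (*-comm j 2) eq)

*2+-linear : ∀ c {x j t} → x + j ≡ t → x * 2 + (c + j * 2) ≡ c + t * 2
*2+-linear c {x} {j} {t} x+j≡t = begin
  x * 2 + (c + j * 2) ≡⟨ x+[y+z]≡y+[x+z] (x * 2) c (j * 2) ⟩
  c + (x * 2 + j * 2) ≡⟨ cong (c +_) (*-distribʳ-+ 2 x j) ⟨
  c + (x + j) * 2     ≡⟨ cong (λ s → c + s * 2) x+j≡t ⟩
  c + t * 2           ∎

module ReflectionFixedPoints {N′ : ℕ} (a : Fin (suc N′)) where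
  private
    N : ℕ
    N = suc N′
    A : ℕ
    A = toℕ a
    σ : Fin N → Fin N
    σ = reflect a

  X*2+A≡X+[X+A] : ∀ X → X * 2 + A ≡ X + (X + A)
  X*2+A≡X+[X+A] X = trans (cong (_+ A) (trans (*-comm X 2) (cong (X +_) (+-identityʳ X)))) (+-assoc X X A)

  -- x is fixed iff 2x + a ≡ N − 1 (mod N), and 2x + a < 2N leaves the two values N − 1 and 2N − 1.
  fixedPoint⇒ : ∀ x → σ x ≡ x → (toℕ x * 2 + A ≡ N′) ⊎ (toℕ x * 2 + A ≡ N′ + N)
  fixedPoint⇒ x σx≡x = by-quotient ((X + A) / N) refl
    where
    X : ℕ
    X = toℕ x
    r : ℕ
    r = (X + A) % N
    X+r≡N′ : X + r ≡ N′
    X+r≡N′ = trans (cong (_+ r) (trans (sym (cong toℕ σx≡x)) (toℕ-reflect a x))) (m∸n+n≡m (≤-pred (m%n<n (X + A) N)))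
    X+A≡ : X + A ≡ r + (X + A) / N * N
    X+A≡ = m≡m%n+[m/n]*n (X + A) N
    by-quotient : ∀ q → (X + A) / N ≡ q → (X * 2 + A ≡ N′) ⊎ (X * 2 + A ≡ N′ + N)
    by-quotient 0 q≡ = inj₁ (begin
      X * 2 + A     ≡⟨ X*2+A≡X+[X+A] X ⟩
      X + (X + A)   ≡⟨ cong (X +_) (trans X+A≡ (trans (cong (λ q → r + q * N) q≡) (+-identityʳ r))) ⟩
      X + r         ≡⟨ X+r≡N′ ⟩
      N′            ∎)
    by-quotient 1 q≡ = inj₂ (begin
      X * 2 + A     ≡⟨ X*2+A≡X+[X+A] X ⟩
      X + (X + A)   ≡⟨ cong (X +_) (trans X+A≡ (cong (λ q → r + q * N) q≡)) ⟩
      X + (r + (N + 0)) ≡⟨ +-assoc X r _ ⟨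
      X + r + (N + 0)   ≡⟨ cong₂ _+_ X+r≡N′ (+-identityʳ N) ⟩
      N′ + N        ∎)
    by-quotient (suc (suc q)) q≡ = ⊥-elim (<-irrefl refl (≤-<-trans 2N≤X+A (+-mono-< (toℕ<n x) (toℕ<n a))))
      where
      2N≤X+A : N + N ≤ X + A
      2N≤X+A = ≤-trans (+-monoʳ-≤ N (m≤m+n N (q * N)))
        (subst (suc (suc q) * N ≤_) (sym (trans X+A≡ (cong (λ q → r + q * N) q≡))) (m≤n+m _ r))

  fixedPoint⇐ : ∀ x → (toℕ x * 2 + A ≡ N′) ⊎ (toℕ x * 2 + A ≡ N′ + N) → σ x ≡ x
  fixedPoint⇐ x (inj₁ 2X+A≡N′) = toℕ-injective (begin
    toℕ (σ x)              ≡⟨ toℕ-reflect a x ⟩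
    N′ ∸ (X + A) % N       ≡⟨ cong (N′ ∸_) (m<n⇒m%n≡m (s≤s (subst (X + A ≤_) X+[X+A]≡N′ (m≤n+m (X + A) X)))) ⟩
    N′ ∸ (X + A)           ≡⟨ cong (_∸ (X + A)) X+[X+A]≡N′ ⟨
    X + (X + A) ∸ (X + A)  ≡⟨ m+n∸n≡m X (X + A) ⟩
    X                      ∎)
    where
    X : ℕ
    X = toℕ x
    X+[X+A]≡N′ : X + (X + A) ≡ N′
    X+[X+A]≡N′ = trans (sym (X*2+A≡X+[X+A] X)) 2X+A≡N′
  fixedPoint⇐ x (inj₂ 2X+A≡N′+N) = toℕ-injective (begin
    toℕ (σ x)              ≡⟨ toℕ-reflect a x ⟩
    N′ ∸ (X + A) % N       ≡⟨ cong (N′ ∸_) [X+A]%N≡u ⟩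
    N′ ∸ u                 ≡⟨ cong (_∸ u) X+u≡N′ ⟨
    X + u ∸ u              ≡⟨ m+n∸n≡m X u ⟩
    X                      ∎)
    where
    X : ℕ
    X = toℕ x
    X+[X+A]≡N′+N : X + (X + A) ≡ N′ + N
    X+[X+A]≡N′+N = trans (sym (X*2+A≡X+[X+A] X)) 2X+A≡N′+N
    N≤X+A : N ≤ X + A
    N≤X+A = +-cancelˡ-≤ N′ N (X + A) (subst (_≤ N′ + (X + A)) X+[X+A]≡N′+N (+-monoˡ-≤ (X + A) (≤-pred (toℕ<n x))))
    u : ℕ
    u = X + A ∸ N
    X+A≡u+N : X + A ≡ u + N
    X+A≡u+N = sym (m∸n+n≡m N≤X+A)
    [X+A]%N≡u : (X + A) % N ≡ u
    [X+A]%N≡u = trans (cong (_% N) X+A≡u+N) (trans ([m+n]%n≡m%n u N)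
      (m<n⇒m%n≡m (+-cancelʳ-< N u N (subst (_< N + N) X+A≡u+N (+-mono-< (toℕ<n x) (toℕ<n a))))))
    X+u≡N′ : X + u ≡ N′
    X+u≡N′ = +-cancelʳ-≡ N (X + u) N′ (trans (+-assoc X u N) (trans (cong (X +_) (sym X+A≡u+N)) X+[X+A]≡N′+N))

  #solutions : ℕ → ℕ
  #solutions T = #[ (λ (x : Fin N) → toℕ x * 2 + A ≟ T) ] (allFin N)

  #fixedPoints≡ : #fixedPoints σ ≡ #solutions N′ + #solutions (N′ + N)
  #fixedPoints≡ = trans
    (#-cong (isFixedPoint? σ) (λ x → (toℕ x * 2 + A ≟ N′) ⊎-dec (toℕ x * 2 + A ≟ N′ + N)) (fixedPoint⇒ _) (fixedPoint⇐ _) (allFin N))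
    (#-⊎ (λ x → toℕ x * 2 + A ≟ N′) (λ x → toℕ x * 2 + A ≟ N′ + N) (λ x → (toℕ x * 2 + A ≟ N′) ⊎-dec (toℕ x * 2 + A ≟ N′ + N))
         (λ ≡N′ ≡N′+N → m≢m+1+n N′ (trans (sym ≡N′) ≡N′+N)) (allFin N))
    where
    m≢m+1+n : ∀ m {n} → m ≢ m + suc n
    m≢m+1+n m eq = <-irrefl eq (m<m+n m (s≤s z≤n))

  #solutions≡1 : ∀ c {j t} → A ≡ c + j * 2 → j ≤ t → t < N → #solutions (c + t * 2) ≡ 1
  #solutions≡1 c {j} {t} A≡ j≤t t<N = enumeration-length
    (filter-enumeration (λ (x : Fin N) → toℕ x * 2 + A ≟ c + t * 2) (λ { refl p → p }) (allFin-enumeration N))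
    (mkEnumeration ((tt , solves) ∷ []) ([] ∷ []) (λ x (_ , x-solves) → here (toℕ-injective (trans (unique x-solves) (sym (toℕ-fromℕ< X<N))))))
    where
    X : ℕ
    X = t ∸ j
    X<N : X < N
    X<N = ≤-<-trans (m∸n≤m t j) t<N
    X-solves : X * 2 + A ≡ c + t * 2
    X-solves = trans (cong (X * 2 +_) A≡) (*2+-linear c {t ∸ j} {j} (m∸n+n≡m j≤t))
    solves : toℕ (fromℕ< X<N) * 2 + A ≡ c + t * 2
    solves = trans (cong (λ y → y * 2 + A) (toℕ-fromℕ< X<N)) X-solves
    unique : ∀ {Y} → Y * 2 + A ≡ c + t * 2 → Y ≡ X
    unique {Y} Y-solves = *-cancelʳ-≡ Y X 2 (+-cancelʳ-≡ A _ _ (trans Y-solves (sym X-solves)))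

  #solutions≡0 : ∀ {T} → (∀ X → X * 2 + A ≢ T) → #solutions T ≡ 0
  #solutions≡0 {T} no-solution = #-none (λ x → toℕ x * 2 + A ≟ T) {allFin N} (All.tabulate λ {x} _ → no-solution (toℕ x))

  #solutions-even≡0 : ∀ {j t} → A ≡ j * 2 → #solutions (1 + t * 2) ≡ 0
  #solutions-even≡0 {j} {t} A≡ = #solutions≡0 λ X eq → *2≢1+*2 (X + j) t (trans (sym (*2+-linear 0 {X} {j} refl)) (trans (cong (X * 2 +_) (sym A≡)) eq))

  #solutions-odd≡0 : ∀ {j t} → A ≡ 1 + j * 2 → #solutions (t * 2) ≡ 0
  #solutions-odd≡0 {j} {t} A≡ = #solutions≡0 λ X eq → *2≢1+*2 t (X + j) (sym (trans (sym (*2+-linear 1 {X} {j} refl)) (trans (cong (X * 2 +_) (sym A≡)) eq)))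

  private
    A≤N′ : A ≤ N′
    A≤N′ = ≤-pred (toℕ<n a)

    p*2+1+p*2 : ∀ p → p * 2 + suc (p * 2) ≡ 1 + (p + p) * 2
    p*2+1+p*2 p = trans (+-suc (p * 2) (p * 2)) (cong suc (sym (*-distribʳ-+ 2 p p)))

    p+1+p : ∀ p → p + suc p ≡ suc (p * 2)
    p+1+p p = trans (+-suc p p) (cong suc (trans (cong (p +_) (sym (+-identityʳ p))) (*-comm 2 p)))

  #fixedPoints-odd : ∀ p → N ≡ 1 + p * 2 → #fixedPoints σ ≡ 1
  #fixedPoints-odd p N≡ with parity A
  ... | inj₁ (j , A≡) = begin
    #fixedPoints σ                           ≡⟨ #fixedPoints≡ ⟩
    #solutions N′ + #solutions (N′ + N)      ≡⟨ cong₂ (λ u v → #solutions u + #solutions v) N′≡ (trans (cong₂ _+_ N′≡ N≡) (p*2+1+p*2 p)) ⟩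
    #solutions (p * 2) + #solutions (1 + (p + p) * 2) ≡⟨ cong₂ _+_ (#solutions≡1 0 A≡ j≤p (subst (p <_) (sym N≡) (s≤s (m≤m*n p 2)))) (#solutions-even≡0 {j} {p + p} A≡) ⟩
    1                                        ∎
    where
    N′≡ : N′ ≡ p * 2
    N′≡ = suc-injective N≡
    j≤p : j ≤ p
    j≤p = *-cancelʳ-≤ j p 2 (subst₂ _≤_ A≡ N′≡ A≤N′)
  ... | inj₂ (j , A≡) = begin
    #fixedPoints σ                           ≡⟨ #fixedPoints≡ ⟩
    #solutions N′ + #solutions (N′ + N)      ≡⟨ cong₂ (λ u v → #solutions u + #solutions v) N′≡ (trans (cong₂ _+_ N′≡ N≡) (p*2+1+p*2 p)) ⟩
    #solutions (p * 2) + #solutions (1 + (p + p) * 2) ≡⟨ cong₂ _+_ (#solutions-odd≡0 {j} {p} A≡) (#solutions≡1 1 A≡ j≤p+p p+p<N) ⟩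
    1                                        ∎
    where
    N′≡ : N′ ≡ p * 2
    N′≡ = suc-injective N≡
    j≤p+p : j ≤ p + p
    j≤p+p = ≤-trans (*-cancelʳ-≤ j p 2 (≤-trans (n≤1+n (j * 2)) (subst₂ _≤_ A≡ N′≡ A≤N′))) (m≤m+n p p)
    p+p<N : p + p < N
    p+p<N = subst (p + p <_) (sym N≡) (s≤s (≤-reflexive (trans (cong (p +_) (sym (+-identityʳ p))) (*-comm 2 p))))

  module _ (p : ℕ) (N≡ : N ≡ suc p * 2) where
    private
      N′≡ : N′ ≡ 1 + p * 2
      N′≡ = suc-injective N≡
      N′+N≡ : N′ + N ≡ 1 + (p + suc p) * 2
      N′+N≡ = trans (cong₂ _+_ N′≡ N≡) (cong suc (sym (*-distribʳ-+ 2 p (suc p))))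
      #fixedPoints≡′ : #fixedPoints σ ≡ #solutions (1 + p * 2) + #solutions (1 + (p + suc p) * 2)
      #fixedPoints≡′ = trans #fixedPoints≡ (cong₂ (λ u v → #solutions u + #solutions v) N′≡ N′+N≡)

    #fixedPoints-even-even : ∀ j → A ≡ j * 2 → #fixedPoints σ ≡ 0
    #fixedPoints-even-even j A≡ = trans #fixedPoints≡′ (cong₂ _+_ (#solutions-even≡0 {j} {p} A≡) (#solutions-even≡0 {j} {p + suc p} A≡))

    #fixedPoints-even-odd : ∀ j → A ≡ 1 + j * 2 → #fixedPoints σ ≡ 2
    #fixedPoints-even-odd j A≡ = trans #fixedPoints≡′ (cong₂ _+_ (#solutions≡1 1 A≡ j≤p p<N) (#solutions≡1 1 A≡ (≤-trans j≤p (m≤m+n p (suc p))) p+1+p<N))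
      where
      j≤p : j ≤ p
      j≤p = *-cancelʳ-≤ j p 2 (≤-pred (subst₂ _≤_ A≡ N′≡ A≤N′))
      p+1+p<N : p + suc p < N
      p+1+p<N = subst₂ _<_ (sym (p+1+p p)) (sym N≡) ≤-refl
      p<N : p < N
      p<N = ≤-<-trans (m≤m+n p (suc p)) p+1+p<N

positives-enumeration : ∀ n → Enumeration (≡.setoid ℕ) (λ j → 1 ≤ j × j ≤ n) (map suc (upTo n))
positives-enumeration n = mkEnumeration (All.tabulate bounds) (AllPairs.map⁺ (AllPairs.map (λ i≢j → i≢j ∘ suc-injective) (upTo⁺ n))) complete′
  where
  bounds : ∀ {x} → x ∈ map suc (upTo n) → 1 ≤ x × x ≤ n
  bounds x∈ with ∈-map⁻ suc x∈
  ... | i , i∈ , refl = s≤s z≤n , ∈-upTo⁻ i∈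
  complete′ : ∀ x → 1 ≤ x × x ≤ n → Any (x ≡_) (map suc (upTo n))
  complete′ (suc i) (_ , i<n) = Any.map⁺ (Any.map (cong suc) (∈-upTo⁺ i<n))

private
  indicator : ℕ → ℕ → ℕ
  indicator v c = #[ (λ x → x ≟ c) ] (v ∷ [])

  indicator-step : ∀ {A : Set} (f : A → ℕ) b bs c → #[ (λ x → f x ≟ c) ] (b ∷ bs) ≡ indicator (f b) c + #[ (λ x → f x ≟ c) ] bs
  indicator-step f b bs c with f b ≟ c
  ... | yes fb≡c = trans (#-accept (λ x → f x ≟ c) bs fb≡c) (cong (_+ _) (sym (#-accept (λ x → x ≟ c) [] fb≡c)))
  ... | no fb≢c  = trans (#-reject (λ x → f x ≟ c) bs fb≢c) (cong (_+ _) (sym (#-reject (λ x → x ≟ c) [] fb≢c)))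

  sum-indicator : ∀ (Z : ℕ → ℕ) {v} cs → AllPairs _≢_ cs → v ∈ cs → sum (map (λ c → Z c * indicator v c) cs) ≡ Z v
  sum-indicator Z (c ∷ cs) (c∉ ∷ _) (here refl) = begin
    Z c * indicator c c + sum (map (λ c′ → Z c′ * indicator c c′) cs) ≡⟨ cong (λ t → Z c * t + sum (map (λ c′ → Z c′ * indicator c c′) cs)) (#-accept (λ x → x ≟ c) [] refl) ⟩
    Z c * 1 + sum (map (λ c′ → Z c′ * indicator c c′) cs)            ≡⟨ cong₂ _+_ (*-identityʳ (Z c)) (sum-zero (All.map (λ {c′} c≢c′ →
                                                                          trans (cong (Z c′ *_) (#-reject (λ x → x ≟ c′) [] c≢c′)) (*-zeroʳ (Z c′))) c∉)) ⟩
    Z c + 0                                                          ≡⟨ +-identityʳ (Z c) ⟩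
    Z c                                                              ∎
  sum-indicator Z {v} (c ∷ cs) (c∉ ∷ distinct) (there v∈) = begin
    Z c * indicator v c + _ ≡⟨ cong (λ t → Z c * t + sum (map (λ c′ → Z c′ * indicator v c′) cs)) (#-reject (λ x → x ≟ c) [] v≢c) ⟩
    Z c * 0 + _             ≡⟨ cong₂ _+_ (*-zeroʳ (Z c)) (sum-indicator Z cs distinct v∈) ⟩
    Z v                     ∎
    where
    v≢c : v ≢ c
    v≢c refl = All.lookup c∉ v∈ refl

sum-regroup : ∀ {A : Set} (Z : ℕ → ℕ) (f : A → ℕ) (cs : List ℕ) → AllPairs _≢_ cs →
  ∀ bs → All (λ b → f b ∈ cs) bs → sum (map (λ b → Z (f b)) bs) ≡ sum (map (λ c → Z c * #[ (λ x → f x ≟ c) ] bs) cs)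
sum-regroup Z f cs distinct []       []           = sym (sum-zero {xs = cs} (All.tabulate λ {c} _ → *-zeroʳ (Z c)))
sum-regroup Z f cs distinct (b ∷ bs) (fb∈ ∷ fbs∈) = begin
  Z (f b) + sum (map (λ b → Z (f b)) bs)
    ≡⟨ cong₂ _+_ (sum-indicator Z cs distinct fb∈) (sym (sum-regroup Z f cs distinct bs fbs∈)) ⟨
  sum (map (λ c → Z c * indicator (f b) c) cs) + sum (map (λ c → Z c * #[ (λ x → f x ≟ c) ] bs) cs)
    ≡⟨ sum-+ _ _ cs ⟨
  sum (map (λ c → Z c * indicator (f b) c + Z c * #[ (λ x → f x ≟ c) ] bs) cs)
    ≡⟨ sum-cong {xs = cs} (All.tabulate λ {c} _ → trans (sym (*-distribˡ-+ (Z c) (indicator (f b) c) _)) (cong (Z c *_) (sym (indicator-step f b bs c)))) ⟩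
  sum (map (λ c → Z c * #[ (λ x → f x ≟ c) ] (b ∷ bs)) cs)
    ∎

gcd[m%n,n]≡gcd[m,n] : ∀ m n .{{_ : NonZero n}} → gcd (m % n) n ≡ gcd m n
gcd[m%n,n]≡gcd[m,n] m n = ∣-antisym
  (gcd-greatest (∣n∣m%n⇒∣m (gcd[m,n]∣n (m % n) n) (gcd[m,n]∣m (m % n) n)) (gcd[m,n]∣n (m % n) n))
  (gcd-greatest (%-presˡ-∣ (gcd[m,n]∣m m n) (gcd[m,n]∣n m n)) (gcd[m,n]∣n m n))

*≡⇒div≡ : ∀ {m} c d → .{{_ : NonZero d}} → c * d ≡ m → m div d ≡ c
*≡⇒div≡ c (suc d) refl = m*n/n≡m c (suc d)

divisors : ℕ → List ℕ
divisors m = filter (_∣? m) (map suc (upTo m))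

divisors-enumeration : ∀ m → Enumeration (≡.setoid ℕ) (λ c → (1 ≤ c × c ≤ m) × c ∣ m) (divisors m)
divisors-enumeration m = filter-enumeration (_∣? m) (λ { refl c∣m → c∣m }) (positives-enumeration m)

coprimes : ℕ → List ℕ
coprimes c = filter (λ j → gcd j c ≟ 1) (map suc (upTo c))

coprimes-enumeration : ∀ c → Enumeration (≡.setoid ℕ) (λ j → (1 ≤ j × j ≤ c) × gcd j c ≡ 1) (coprimes c)
coprimes-enumeration c = filter-enumeration (λ j → gcd j c ≟ 1) (λ { refl g≡1 → g≡1 }) (positives-enumeration c)

module Order (m′ : ℕ) where
  private
    m : ℕ
    m = suc m′

  gcd[b,m]≢0 : ∀ (b : Fin m) → NonZero (gcd (toℕ b) m)
  gcd[b,m]≢0 b = ≢-nonZero (gcd[m,n]≢0 (toℕ b) m (inj₂ λ ()))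

  order : Fin m → ℕ
  order b = m div gcd (toℕ b) m

  order-divisor : ∀ b → (1 ≤ order b × order b ≤ m) × order b ∣ m
  order-divisor b = subst (λ c → (1 ≤ c × c ≤ m) × c ∣ m) (sym (div≡/ m g))
    ((m≥n⇒m/n>0 (gcd[m,n]≤n (toℕ b) m) , m/n≤m m g) , m/n∣m (gcd[m,n]∣n (toℕ b) m))
    where
    g : ℕ
    g = gcd (toℕ b) m
    instance
      g-nonZero : NonZero g
      g-nonZero = gcd[b,m]≢0 b

  module _ (c : ℕ) .{{_ : NonZero c}} (c∣m : c ∣ m) where
    private
      d : ℕ
      d = m / c
      d*c≡m : d * c ≡ m
      d*c≡m = m/n*n≡m c∣m
      c*d≡m : c * d ≡ m
      c*d≡m = trans (*-comm c d) d*c≡m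
      d≢0 : d ≢ 0
      d≢0 d≡0 = 0≢1+n (trans (sym (cong (_* c) d≡0)) d*c≡m)
      instance
        d-nonZero : NonZero d
        d-nonZero = ≢-nonZero d≢0

      -- The elements of order c are the multiples j · (m / c) with 1 ≤ j ≤ c and gcd (j , c) = 1.
      multiple : ℕ → Fin m
      multiple j = (j * d) mod m

      multiple-value : ∀ j → j ≤ c → (j * d) % m ≡ j * d ⊎ (j ≡ c × (j * d) % m ≡ 0)
      multiple-value j j≤c with j <? c
      ... | yes j<c = inj₁ (m<n⇒m%n≡m (subst (j * d <_) c*d≡m (*-monoˡ-< d j<c)))
      ... | no j≮c  = inj₂ (j≡c , trans (cong (λ t → (t * d) % m) j≡c) (trans (cong (_% m) c*d≡m) (n%n≡0 m)))
        where
        j≡c : j ≡ c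
        j≡c = ≤-antisym j≤c (≮⇒≥ j≮c)

      order-multiple : ∀ j → gcd j c ≡ 1 → order (multiple j) ≡ c
      order-multiple j coprime = trans (cong (m div_) gcd≡d) (*≡⇒div≡ c d c*d≡m)
        where
        gcd≡d : gcd (toℕ (multiple j)) m ≡ d
        gcd≡d = begin
          gcd (toℕ (multiple j)) m  ≡⟨ cong (λ t → gcd t m) (toℕ-mod (j * d) m) ⟩
          gcd ((j * d) % m) m       ≡⟨ gcd[m%n,n]≡gcd[m,n] (j * d) m ⟩
          gcd (j * d) m             ≡⟨ cong₂ gcd (*-comm j d) (sym d*c≡m) ⟩
          gcd (d * j) (d * c)       ≡⟨ c*gcd[m,n]≡gcd[cm,cn] d j c ⟨
          d * gcd j c               ≡⟨ cong (d *_) coprime ⟩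
          d * 1                     ≡⟨ *-identityʳ d ⟩
          d                         ∎

      *d≢0 : ∀ {j} → 1 ≤ j → j * d ≢ 0
      *d≢0 {suc j} _ j*d≡0 = d≢0 (m+n≡0⇒m≡0 d j*d≡0)

      multiple-≡ : ∀ {j j′} → multiple j ≡ multiple j′ → (j * d) % m ≡ (j′ * d) % m
      multiple-≡ {j} {j′} eq = trans (sym (toℕ-mod (j * d) m)) (trans (cong toℕ eq) (toℕ-mod (j′ * d) m))

      multiple-injective : ∀ {j j′} → 1 ≤ j → j ≤ c → 1 ≤ j′ → j′ ≤ c → multiple j ≡ multiple j′ → j ≡ j′
      multiple-injective {j} {j′} 1≤j j≤c 1≤j′ j′≤c eq with multiple-value j j≤c | multiple-value j′ j′≤c | multiple-≡ {j} {j′} eq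
      ... | inj₁ v         | inj₁ v′         | eq% = *-cancelʳ-≡ j j′ d (trans (sym v) (trans eq% v′))
      ... | inj₁ v         | inj₂ (_ , v′)   | eq% = ⊥-elim (*d≢0 1≤j (trans (sym v) (trans eq% v′)))
      ... | inj₂ (_ , v)   | inj₁ v′         | eq% = ⊥-elim (*d≢0 1≤j′ (trans (sym v′) (trans (sym eq%) v)))
      ... | inj₂ (j≡c , _) | inj₂ (j′≡c , _) | _   = trans j≡c (sym j′≡c)

      multiple-onto : ∀ (b : Fin m) → order b ≡ c → ∃ λ j → ((1 ≤ j × j ≤ c) × gcd j c ≡ 1) × b ≡ multiple j
      multiple-onto b order≡c = from-quotient (B / G) refl
        where
        B : ℕ
        B = toℕ b
        G : ℕ
        G = gcd B m
        instance
          G-nonZero : NonZero G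
          G-nonZero = gcd[b,m]≢0 b
        G≡d : G ≡ d
        G≡d = *-cancelˡ-≡ G d c (begin
          c * G        ≡⟨ cong (_* G) (trans (sym order≡c) (div≡/ m G)) ⟩
          m / G * G    ≡⟨ m/n*n≡m (gcd[m,n]∣n B m) ⟩
          m            ≡⟨ c*d≡m ⟨
          c * d        ∎)
        B≡ : ∀ {j} → B / G ≡ j → B ≡ j * d
        B≡ {j} q≡ = trans (sym (m/n*n≡m (gcd[m,n]∣m B m))) (cong₂ _*_ q≡ G≡d)
        j<c : ∀ {j} → B ≡ j * d → j < c
        j<c {j} B≡j*d = *-cancelʳ-< d j c (subst₂ _<_ B≡j*d (sym c*d≡m) (toℕ<n b))
        coprime : ∀ {j} → B ≡ j * d → gcd j c ≡ 1
        coprime {j} B≡j*d = *-cancelˡ-≡ (gcd j c) 1 d (begin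
          d * gcd j c          ≡⟨ c*gcd[m,n]≡gcd[cm,cn] d j c ⟩
          gcd (d * j) (d * c)  ≡⟨ cong₂ gcd (trans (*-comm d j) (sym B≡j*d)) (trans (*-comm d c) c*d≡m) ⟩
          G                    ≡⟨ G≡d ⟩
          d                    ≡⟨ *-identityʳ d ⟨
          d * 1                ∎)
        from-quotient : ∀ j → B / G ≡ j → ∃ λ j → ((1 ≤ j × j ≤ c) × gcd j c ≡ 1) × b ≡ multiple j
        from-quotient (suc j) q≡ = suc j , ((s≤s z≤n , <⇒≤ (j<c (B≡ q≡))) , coprime (B≡ q≡)) ,
          toℕ-injective (sym (trans (toℕ-mod (suc j * d) m) (trans (cong (_% m) (sym (B≡ q≡))) (m<n⇒m%n≡m (toℕ<n b)))))
        from-quotient zero q≡ = 1 , ((s≤s z≤n , >-nonZero⁻¹ c) , gcd-zeroˡ c) ,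
          toℕ-injective (trans (B≡ q≡) (sym (trans (toℕ-mod (1 * d) m) (trans (cong (_% m) (trans (*-identityˡ d) d≡m)) (n%n≡0 m)))))
          where
          c≡1 : c ≡ 1
          c≡1 = trans (sym (gcd-identityˡ c)) (coprime {0} (B≡ q≡))
          d≡m : d ≡ m
          d≡m = trans (sym (*-identityˡ d)) (trans (cong (_* d) (sym c≡1)) c*d≡m)

    #order≡totient : #[ (λ b → order b ≟ c) ] (allFin m) ≡ totient c
    #order≡totient = begin
      #[ (λ b → order b ≟ c) ] (allFin m)  ≡⟨ enumeration-length ofOrder multiples ⟩
      length (map multiple (coprimes c))   ≡⟨ length-map multiple (coprimes c) ⟩
      totient c                            ∎
      where
      ofOrder : Enumeration (≡.setoid (Fin m)) (λ b → ⊤ × order b ≡ c) (filter (λ b → order b ≟ c) (allFin m))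
      ofOrder = filter-enumeration (λ b → order b ≟ c) (λ { refl o → o }) (allFin-enumeration m)
      multiples : Enumeration (≡.setoid (Fin m)) (λ b → ⊤ × order b ≡ c) (map multiple (coprimes c))
      multiples = map-enumeration multiple (cong multiple)
        (λ j (_ , coprime) → tt , order-multiple j coprime)
        (λ ((1≤j , j≤c) , _) ((1≤j′ , j′≤c) , _) → multiple-injective 1≤j j≤c 1≤j′ j′≤c)
        (λ b (_ , order≡c) → multiple-onto b order≡c)
        (coprimes-enumeration c)

  sum-by-order : ∀ (Z : ℕ → ℕ) → sum (map (λ b → Z (order b)) (allFin m)) ≡ divSum m (λ c → totient c * Z c)
  sum-by-order Z = trans
    (sum-regroup Z order (divisors m) (distinct (divisors-enumeration m)) (allFin m)
      (All.tabulate λ {b} _ → complete (divisors-enumeration m) (order b) (order-divisor b)))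
    (sum-cong (All.map (λ { {c} ((1≤c , _) , c∣m) → trans (cong (Z c *_) (#order≡totient c {{>-nonZero 1≤c}} c∣m)) (*-comm (Z c) _) })
                       (sound (divisors-enumeration m))))

module Exponents (M′ B : ℕ) where
  private
    M : ℕ
    M = suc M′

  G : ℕ
  G = gcd B M
  C : ℕ
  C = M div G
  G₂ : ℕ
  G₂ = gcd (B + B) M

  instance
    G-nonZero : NonZero G
    G-nonZero = ≢-nonZero (gcd[m,n]≢0 B M (inj₂ λ ()))
    G₂-nonZero : NonZero G₂
    G₂-nonZero = ≢-nonZero (gcd[m,n]≢0 (B + B) M (inj₂ λ ()))

  private
    u : ℕ
    u = B / G

    C*G≡M : C * G ≡ M
    C*G≡M = trans (cong (_* G) (div≡/ M G)) (m/n*n≡m (gcd[m,n]∣n B M))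

    u*G≡B : u * G ≡ B
    u*G≡B = m/n*n≡m (gcd[m,n]∣m B M)

    C≢0 : C ≢ 0
    C≢0 C≡0 = 0≢1+n (trans (sym (cong (_* G) C≡0)) C*G≡M)

    instance
      C-nonZero : NonZero C
      C-nonZero = ≢-nonZero C≢0

    coprime : Coprime C u
    coprime = subst (λ c → Coprime c u) (sym (div≡/ M G)) (Coprime.sym (coprime-/gcd B M))

    gcd[u*2,C]≡gcd[2,C] : gcd (u * 2) C ≡ gcd 2 C
    gcd[u*2,C]≡gcd[2,C] = ∣-antisym
      (gcd-greatest (coprime-divisor (λ (e∣ , e∣u) → coprime (∣-trans e∣ (gcd[m,n]∣n (u * 2) C) , e∣u)) (gcd[m,n]∣m (u * 2) C))
                    (gcd[m,n]∣n (u * 2) C))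
      (gcd-greatest (∣-trans (gcd[m,n]∣m 2 C) (n∣m*n u)) (gcd[m,n]∣n 2 C))

  G₂≡G*gcd[2,C] : G₂ ≡ G * gcd 2 C
  G₂≡G*gcd[2,C] = begin
    gcd (B + B) M              ≡⟨ cong₂ gcd B+B≡ (trans (sym C*G≡M) (*-comm C G)) ⟩
    gcd (G * (u * 2)) (G * C)  ≡⟨ c*gcd[m,n]≡gcd[cm,cn] G (u * 2) C ⟨
    G * gcd (u * 2) C          ≡⟨ cong (G *_) gcd[u*2,C]≡gcd[2,C] ⟩
    G * gcd 2 C                ∎
    where
    B+B≡ : B + B ≡ G * (u * 2)
    B+B≡ = begin
      B + B              ≡⟨ cong (λ t → t + t) u*G≡B ⟨
      u * G + u * G      ≡⟨ *-distribʳ-+ G u u ⟨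
      (u + u) * G        ≡⟨ *-comm (u + u) G ⟩
      G * (u + u)        ≡⟨ cong (λ t → G * (u + t)) (+-identityʳ u) ⟨
      G * (2 * u)        ≡⟨ cong (G *_) (*-comm 2 u) ⟩
      G * (u * 2)        ∎

  G₂*lcm[2,C]≡2*M : G₂ * lcm 2 C ≡ 2 * M
  G₂*lcm[2,C]≡2*M = begin
    G₂ * lcm 2 C             ≡⟨ cong (_* lcm 2 C) G₂≡G*gcd[2,C] ⟩
    G * gcd 2 C * lcm 2 C    ≡⟨ *-assoc G (gcd 2 C) (lcm 2 C) ⟩
    G * (gcd 2 C * lcm 2 C)  ≡⟨ cong (G *_) (gcd*lcm 2 C) ⟩
    G * (2 * C)              ≡⟨ x*[y*z]≡y*[x*z] G 2 C ⟩
    2 * (G * C)              ≡⟨ cong (2 *_) (trans (*-comm G C) C*G≡M) ⟩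
    2 * M                    ∎

  M-div-C : M div C ≡ G
  M-div-C = *≡⇒div≡ G C (trans (*-comm G C) C*G≡M)

  2*M-div-C : (2 * M) div C ≡ G * 2
  2*M-div-C = *≡⇒div≡ (G * 2) C (trans (*-assoc G 2 C) (trans (x*[y*z]≡y*[x*z] G 2 C) (cong (2 *_) (trans (*-comm G C) C*G≡M))))

  q*2*M-div-lcm : ∀ q → (q * (2 * M)) div lcm 2 C ≡ G₂ * q
  q*2*M-div-lcm q = *≡⇒div≡ (G₂ * q) (lcm 2 C) {{lcm-nonZero}} (begin
    G₂ * q * lcm 2 C    ≡⟨ reassociate ⟩
    q * (G₂ * lcm 2 C)  ≡⟨ cong (q *_) G₂*lcm[2,C]≡2*M ⟩
    q * (2 * M)         ∎)
    where
    lcm-nonZero : NonZero (lcm 2 C)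
    lcm-nonZero = ≢-nonZero λ lcm≡0 → 0≢1+n (trans (sym (trans (cong (G₂ *_) lcm≡0) (*-zeroʳ G₂))) (trans G₂*lcm[2,C]≡2*M (cong suc (+-suc M′ _))))
    reassociate : G₂ * q * lcm 2 C ≡ q * (G₂ * lcm 2 C)
    reassociate = trans (*-assoc G₂ q _) (x*[y*z]≡y*[x*z] G₂ q _)

sum-alternating : ∀ p {n} → n ≡ p * 2 → (f : Fin n → ℕ) {X Y : ℕ} → (∀ a → toℕ a % 2 ≡ 0 → f a ≡ X) → (∀ a → toℕ a % 2 ≡ 1 → f a ≡ Y) →
                  sum (map f (allFin n)) ≡ p * (X + Y)
sum-alternating p refl f even odd = trans (cong sum (map-tabulate (λ i → i) f)) (go p f even odd)
  where
  go : ∀ p (f : Fin (p * 2) → ℕ) {X Y} → (∀ a → toℕ a % 2 ≡ 0 → f a ≡ X) → (∀ a → toℕ a % 2 ≡ 1 → f a ≡ Y) →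
       sum (tabulate f) ≡ p * (X + Y)
  go zero    f even odd = refl
  go (suc p) f {X} {Y} even odd = trans
    (cong₂ _+_ (even zero refl) (cong₂ _+_ (odd (suc zero) refl)
      (go p (λ a → f (suc (suc a))) (λ a a-even → even _ (trans (2+a%2 a) a-even)) (λ a a-odd → odd _ (trans (2+a%2 a) a-odd)))))
    (sym (+-assoc X Y (p * (X + Y))))
    where
    2+a%2 : ∀ (a : Fin (p * 2)) → (2 + toℕ a) % 2 ≡ toℕ a % 2
    2+a%2 a = trans (%-congˡ (+-comm 2 (toℕ a))) ([m+n]%n≡m%n (toℕ a) 2)

module TranslationSums {K N′ M′ : ℕ} (h : Fin K → Fin K) (h-involutive : ∀ d → h (h d) ≡ d) where
  private
    N : ℕ
    N = suc N′
    M : ℕ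
    M = suc M′
    module E (b : Fin M) = Exponents M′ (toℕ b)
    module F (a : Fin N) = ReflectionFixedPoints a

  #glideFixed≡ : ∀ a b → #glideFixed a b h ≡
    (#fixed h (E.C b) ^ E.G b) ^ #fixedPoints (reflect a) * (K ^ E.G₂ b) ^ #leaders (reflect a)
  #glideFixed≡ a b = by-tiles K h h-involutive
    where
    0^-≡0 : ∀ g → NonZero g → 0 ^ g ≡ 0
    0^-≡0 (suc g) _ = refl
    0^F*0^R≡0 : ∀ F R → F + (R + R) ≡ N → 0 ^ F * 0 ^ R ≡ 0
    0^F*0^R≡0 (suc F) R _       = refl
    0^F*0^R≡0 zero    (suc R) _ = refl
    -- GlideReflection needs a tile for v₀; without tiles both sides vanish since n ≥ 1.
    by-tiles : ∀ K (h : Fin K → Fin K) (h-involutive : ∀ d → h (h d) ≡ d) → #glideFixed a b h ≡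
      (#fixed h (E.C b) ^ E.G b) ^ #fixedPoints (reflect a) * (K ^ E.G₂ b) ^ #leaders (reflect a)
    by-tiles (suc k′) h h-involutive = GlideReflection.#glideFixed≡ a b h h-involutive
    by-tiles zero h _ = sym (begin
      (0 ^ E.G b) ^ #fixedPoints (reflect a) * (0 ^ E.G₂ b) ^ #leaders (reflect a)
        ≡⟨ cong₂ (λ x y → x ^ #fixedPoints (reflect a) * y ^ #leaders (reflect a)) (0^-≡0 (E.G b) (E.G-nonZero b)) (0^-≡0 (E.G₂ b) (E.G₂-nonZero b)) ⟩
      0 ^ #fixedPoints (reflect a) * 0 ^ #leaders (reflect a)
        ≡⟨ 0^F*0^R≡0 (#fixedPoints (reflect a)) (#leaders (reflect a)) (#fixedPoints+2*#leaders (reflect a) (reflect-involutive a)) ⟩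
      0 ∎)

  Σglide : ℕ
  Σglide = sum (map (λ a → sum (map (λ b → #glideFixed a b h) (allFin M))) (allFin N))

  oddSummand : ℕ → ℕ
  oddSummand c = K ^ (((N ∸ 1) * M) div lcm 2 c) * #fixed h c ^ (M div c)

  evenSummand : ℕ → ℕ
  evenSummand c = K ^ ((N * M) div lcm 2 c) + K ^ (((N ∸ 2) * M) div lcm 2 c) * #fixed h c ^ ((2 * M) div c)

  private
    half : ∀ {R r} → R + R ≡ r * 2 → R ≡ r
    half {R} {r} R+R≡ = *-cancelʳ-≡ R r 2 (trans (trans (*-comm R 2) (cong (R +_) (+-identityʳ R))) R+R≡)

    #leaders≡ : ∀ a {F r} → #fixedPoints (reflect a) ≡ F → F + r * 2 ≡ N → #leaders (reflect a) ≡ r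
    #leaders≡ a {F} F≡ F+r*2≡N = half (+-cancelˡ-≡ F _ _ (trans (cong (_+ _) (sym F≡)) (trans (#fixedPoints+2*#leaders (reflect a) (reflect-involutive a)) (sym F+r*2≡N))))

    A≡ : ∀ (a : Fin N) {r} → toℕ a % 2 ≡ r → toℕ a ≡ r + toℕ a / 2 * 2
    A≡ a a%2≡r = trans (m≡m%n+[m/n]*n (toℕ a) 2) (cong (_+ toℕ a / 2 * 2) a%2≡r)

    #glideFixed-by-counts : ∀ a b {F r} → #fixedPoints (reflect a) ≡ F → F + r * 2 ≡ N →
      #glideFixed a b h ≡ (#fixed h (E.C b) ^ E.G b) ^ F * (K ^ E.G₂ b) ^ r
    #glideFixed-by-counts a b {F} {r} F≡ F+r*2≡N = trans (#glideFixed≡ a b)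
      (cong₂ (λ i j → (#fixed h (E.C b) ^ E.G b) ^ i * (K ^ E.G₂ b) ^ j) F≡ (#leaders≡ a {r = r} F≡ F+r*2≡N))

    exponent : ∀ b q {n} → n ≡ q * 2 → (n * M) div lcm 2 (E.C b) ≡ E.G₂ b * q
    exponent b q n≡ = trans (cong (λ t → (t * M) div lcm 2 (E.C b)) n≡) (trans (cong (_div lcm 2 (E.C b)) (*-assoc q 2 M)) (E.q*2*M-div-lcm b q))

  #glideFixed-odd : ∀ r → N ≡ 1 + r * 2 → ∀ a b → #glideFixed a b h ≡ oddSummand (E.C b)
  #glideFixed-odd r N≡ a b = begin
    #glideFixed a b h                    ≡⟨ #glideFixed-by-counts a b {r = r} (F.#fixedPoints-odd a r N≡) (sym N≡) ⟩
    (P ^ E.G b) ^ 1 * (K ^ E.G₂ b) ^ r   ≡⟨ cong₂ _*_ (^-identityʳ (P ^ E.G b)) (^-*-assoc K (E.G₂ b) r) ⟩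
    P ^ E.G b * K ^ (E.G₂ b * r)         ≡⟨ *-comm (P ^ E.G b) _ ⟩
    K ^ (E.G₂ b * r) * P ^ E.G b         ≡⟨ cong₂ (λ x y → K ^ x * P ^ y) (exponent b r (suc-injective N≡)) (E.M-div-C b) ⟨
    oddSummand (E.C b)                   ∎
    where
    P : ℕ
    P = #fixed h (E.C b)

  module _ (p′ : ℕ) (N≡ : N ≡ suc p′ * 2) where

    #glideFixed-even-even : ∀ a → toℕ a % 2 ≡ 0 → ∀ b → #glideFixed a b h ≡ K ^ (E.G₂ b * suc p′)
    #glideFixed-even-even a a-even b = begin
      #glideFixed a b h                               ≡⟨ #glideFixed-by-counts a b {r = suc p′} (F.#fixedPoints-even-even a p′ N≡ (toℕ a / 2) (A≡ a a-even)) (sym N≡) ⟩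
      (#fixed h (E.C b) ^ E.G b) ^ 0 * (K ^ E.G₂ b) ^ suc p′ ≡⟨ trans (*-identityˡ _) (^-*-assoc K (E.G₂ b) (suc p′)) ⟩
      K ^ (E.G₂ b * suc p′)                           ∎

    #glideFixed-even-odd : ∀ a → toℕ a % 2 ≡ 1 → ∀ b → #glideFixed a b h ≡ K ^ (E.G₂ b * p′) * #fixed h (E.C b) ^ (E.G b * 2)
    #glideFixed-even-odd a a-odd b = begin
      #glideFixed a b h                               ≡⟨ #glideFixed-by-counts a b {r = p′} (F.#fixedPoints-even-odd a p′ N≡ (toℕ a / 2) (A≡ a a-odd)) (sym N≡) ⟩
      (P ^ E.G b) ^ 2 * (K ^ E.G₂ b) ^ p′             ≡⟨ cong₂ _*_ (^-*-assoc P (E.G b) 2) (^-*-assoc K (E.G₂ b) p′) ⟩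
      P ^ (E.G b * 2) * K ^ (E.G₂ b * p′)             ≡⟨ *-comm (P ^ (E.G b * 2)) _ ⟩
      K ^ (E.G₂ b * p′) * P ^ (E.G b * 2)             ∎
      where
      P : ℕ
      P = #fixed h (E.C b)

    evenSummand≡ : ∀ b → evenSummand (E.C b) ≡ K ^ (E.G₂ b * suc p′) + K ^ (E.G₂ b * p′) * #fixed h (E.C b) ^ (E.G b * 2)
    evenSummand≡ b = cong₂ _+_ (cong (K ^_) (exponent b (suc p′) N≡))
      (cong₂ (λ x y → K ^ x * #fixed h (E.C b) ^ y) (exponent b p′ (cong (_∸ 2) N≡)) (E.2*M-div-C b))

  Σglide-odd : ¬ 2 ∣ N → Σglide ≡ N * divSum M (λ c → totient c * oddSummand c)
  Σglide-odd 2∤N with parity N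
  ... | inj₁ (j , N≡) = ⊥-elim (2∤N (divides j N≡))
  ... | inj₂ (r , N≡) = begin
    Σglide                                             ≡⟨ sum-cong {xs = allFin N} (All.tabulate λ {a} _ →
                                                            sum-cong {xs = allFin M} (All.tabulate λ {b} _ → #glideFixed-odd r N≡ a b)) ⟩
    sum (map (λ _ → W) (allFin N))                     ≡⟨ sum-const W (allFin N) ⟩
    length (allFin N) * W                              ≡⟨ cong (_* W) (length-tabulate {n = N} (λ i → i)) ⟩
    N * W                                              ≡⟨ cong (N *_) (Order.sum-by-order M′ oddSummand) ⟩
    N * divSum M (λ c → totient c * oddSummand c)      ∎
    where
    W : ℕ
    W = sum (map (λ b → oddSummand (E.C b)) (allFin M))

  Σglide-even : 2 ∣ N → 2 * Σglide ≡ N * divSum M (λ c → totient c * evenSummand c)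
  Σglide-even (divides zero ())
  Σglide-even (divides (suc p′) N≡) = begin
    2 * Σglide                                            ≡⟨ cong (2 *_) (sum-alternating p N≡ _
                                                               (λ a a-even → sum-cong {xs = allFin M} (All.tabulate λ {b} _ → #glideFixed-even-even p′ N≡ a a-even b))
                                                               (λ a a-odd → sum-cong {xs = allFin M} (All.tabulate λ {b} _ → #glideFixed-even-odd p′ N≡ a a-odd b))) ⟩
    2 * (p * (W₀ + W₁))                                   ≡⟨ trans (sym (*-assoc 2 p _)) (cong (_* (W₀ + W₁)) (trans (*-comm 2 p) (sym N≡))) ⟩
    N * (W₀ + W₁)                                         ≡⟨ cong (N *_) (sum-+ X₀ X₁ (allFin M)) ⟨
    N * sum (map (λ b → X₀ b + X₁ b) (allFin M))         ≡⟨ cong (N *_) (sum-cong {xs = allFin M} (All.tabulate λ {b} _ → sym (evenSummand≡ p′ N≡ b))) ⟩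
    N * sum (map (λ b → evenSummand (E.C b)) (allFin M)) ≡⟨ cong (N *_) (Order.sum-by-order M′ evenSummand) ⟩
    N * divSum M (λ c → totient c * evenSummand c)        ∎
    where
    p : ℕ
    p = suc p′
    X₀ X₁ : Fin M → ℕ
    X₀ b = K ^ (E.G₂ b * p)
    X₁ b = K ^ (E.G₂ b * p′) * #fixed h (E.C b) ^ (E.G b * 2)
    W₀ W₁ : ℕ
    W₀ = sum (map X₀ (allFin M))
    W₁ = sum (map X₁ (allFin M))

module _ {K N′ M′ : ℕ} (a : Fin (suc N′)) (b : Fin (suc M′)) (h : Fin K → Fin K) where
  private
    N : ℕ
    N = suc N′
    M : ℕ
    M = suc M′

  -- The fixedness condition for ((a , b) , r²f); transposing turns it into GlideFixed b a h.
  TransposedGlideFixed : (Fin N → Fin M → Fin K) → Set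
  TransposedGlideFixed τ = ∀ x y → τ (addMod x a) (reflect b y) ≡ h (τ x y)

  transposedGlideFixed? : ∀ τ → Dec (TransposedGlideFixed τ)
  transposedGlideFixed? τ = all? (λ x → all? (λ y → τ (addMod x a) (reflect b y) ≟ᶠ h (τ x y)))

  #transposedGlideFixed≡ : #[ transposedGlideFixed? ] (allFuns N (allFuns M (allFin K))) ≡ #glideFixed b a h
  #transposedGlideFixed≡ = begin
    #[ transposedGlideFixed? ] (allFuns N (allFuns M (allFin K))) ≡⟨ enumeration-length (fixed N M transposedGlideFixed? TransposedGlideFixed-resp) transposes ⟩
    length (map transpose (filter (glideFixed? b a h) (allFuns M (allFuns N (allFin K))))) ≡⟨ length-map transpose (filter (glideFixed? b a h) (allFuns M (allFuns N (allFin K)))) ⟩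
    #glideFixed b a h ∎
    where
    transpose : ∀ {n m} → (Fin m → Fin n → Fin K) → Fin n → Fin m → Fin K
    transpose τ x y = τ y x
    Tilings : ℕ → ℕ → Setoid 0ℓ 0ℓ
    Tilings n m = Vectors (TileVectors K m) n
    fixed : ∀ n m {P : (Fin n → Fin m → Fin K) → Set} (P? : ∀ τ → Dec (P τ)) → (∀ {τ τ′} → (∀ x y → τ x y ≡ τ′ x y) → P τ → P τ′) →
            Enumeration (Tilings n m) (λ τ → ⊤ × P τ) (filter P? (allFuns n (allFuns m (allFin K))))
    fixed n m P? P-resp = filter-enumeration P? P-resp
      (allFuns-enumeration-⊤ n (allFuns-enumeration-⊤ m (allFin-enumeration K)))
    TransposedGlideFixed-resp : ∀ {τ τ′} → (∀ x y → τ x y ≡ τ′ x y) → TransposedGlideFixed τ → TransposedGlideFixed τ′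
    TransposedGlideFixed-resp τ≋τ′ τ-fixed x y = trans (sym (τ≋τ′ _ _)) (trans (τ-fixed x y) (cong h (τ≋τ′ x y)))
    transposes : Enumeration (Tilings N M) (λ τ → ⊤ × TransposedGlideFixed τ) (map transpose (filter (glideFixed? b a h) (allFuns M (allFuns N (allFin K)))))
    transposes = map-enumeration transpose (λ τ≋τ′ x y → τ≋τ′ y x)
      (λ τ (_ , τ-fixed) → tt , λ x y → τ-fixed y x)
      (λ _ _ τᵀ≋τ′ᵀ y x → τᵀ≋τ′ᵀ x y)
      (λ τ (_ , τ-fixed) → transpose τ , (tt , λ y x → τ-fixed x y) , λ x y → refl)
      (fixed M N (glideFixed? b a h) (λ τ≋τ′ τ-fixed x y → trans (sym (τ≋τ′ _ _)) (trans (τ-fixed x y) (cong h (τ≋τ′ x y)))))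

El-≡ : ∀ {R : Subgroup} {x y : D4} {p : mem R x ≡ true} {q : mem R y ≡ true} → x ≡ y → _≡_ {A = El R} (x , p) (y , q)
El-≡ {p = p} {q} refl = cong (_ ,_) (Decidable⇒UIP.≡-irrelevant Bool._≟_ p q)

module TileAction {R : Subgroup} (T : TileSet R) (g : El R) where

  h : Fin (#tiles T) → Fin (#tiles T)
  h d = act T d g

  act-pow : ∀ c d → act T d (powᴿ {R} g c) ≡ iter h c d
  act-pow zero    d = act-e T d
  act-pow (suc c) d = trans (sym (act-mul T d g (powᴿ {R} g c))) (trans (act-pow c (h d)) (iter-comm c d))
    where
    iter-comm : ∀ c d → iter h c (h d) ≡ h (iter h c d)
    iter-comm zero    d = refl
    iter-comm (suc c) d = cong h (iter-comm c d)

  tcount-pow : ∀ c → tcount T (powᴿ {R} g c) ≡ #fixed h c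
  tcount-pow c = #-cong _ (iterFixed? h c) (λ {d} fixed → trans (sym (act-pow c d)) fixed) (λ {d} fixed → trans (act-pow c d) fixed) (allFin (#tiles T))

  tcount-e : tcount T (eᴿ R) ≡ #tiles T
  tcount-e = trans (#-all (λ d → act T d (eᴿ R) ≟ᶠ d) {allFin (#tiles T)} (All.tabulate λ {d} _ → act-e T d)) (length-tabulate (λ i → i))

  h-involutive : proj₁ g · proj₁ g ≡ idᴰ → ∀ d → h (h d) ≡ d
  h-involutive g·g≡e d = trans (act-mul T d g g) (trans (cong (act T d) (El-≡ {R} g·g≡e)) (act-e T d))

divSum-cong : ∀ m {F F′ : ℕ → ℕ} → (∀ c → F c ≡ F′ c) → divSum m F ≡ divSum m F′
divSum-cong m F≗F′ = sum-cong {xs = divisors m} (All.tabulate λ {c} _ → F≗F′ c)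

FixTor-r2f≡Σglide : ∀ {R : Subgroup} (T : TileSet R) {N′ M′} (pf : mem R r2f ≡ true) →
  FixTor T (suc N′) (suc M′) (r2f , pf) ≡ TranslationSums.Σglide {#tiles T} {M′} {N′} (TileAction.h T (r2f , pf)) (TileAction.h-involutive T (r2f , pf) refl)
FixTor-r2f≡Σglide T {N′} {M′} pf = trans
  (sum-cong {xs = allFin (suc N′)} (All.tabulate λ {a} _ → sum-cong {xs = allFin (suc M′)} (All.tabulate λ {b} _ → #transposedGlideFixed≡ a b (TileAction.h T (r2f , pf)))))
  (sum-swap (λ a b → #glideFixed b a (TileAction.h T (r2f , pf))) (allFin (suc N′)) (allFin (suc M′)))

module _ {R : Subgroup} (T : TileSet R) (N′ M′ : ℕ) where
  private
    n m : ℕ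
    n = suc N′
    m = suc M′

  FixTor-flip-even : (pf : mem R fl ≡ true) → 2 ∣ n → 2 * FixTor T n m (fl , pf) ≡
    n * divSum m (λ c → totient c *
      (tcount T (eᴿ R) ^ ((n * m) div lcm 2 c) + tcount T (eᴿ R) ^ (((n ∸ 2) * m) div lcm 2 c) * tcount T (powᴿ {R} (fl , pf) c) ^ ((2 * m) div c)))
  FixTor-flip-even pf 2∣n = trans (Σglide-even 2∣n) (cong (n *_) (divSum-cong m λ c → cong (totient c *_)
    (cong₂ _+_ (cong (_^ ((n * m) div lcm 2 c)) (sym tcount-e))
               (cong₂ _*_ (cong (_^ (((n ∸ 2) * m) div lcm 2 c)) (sym tcount-e)) (cong (_^ ((2 * m) div c)) (sym (tcount-pow c)))))))
    where
    open TileAction T (fl , pf)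
    open TranslationSums {#tiles T} {N′} {M′} h (h-involutive refl)

  FixTor-flip-odd : (pf : mem R fl ≡ true) → ¬ (2 ∣ n) → FixTor T n m (fl , pf) ≡
    n * divSum m (λ c → totient c * (tcount T (eᴿ R) ^ (((n ∸ 1) * m) div lcm 2 c) * tcount T (powᴿ {R} (fl , pf) c) ^ (m div c)))
  FixTor-flip-odd pf 2∤n = trans (Σglide-odd 2∤n) (cong (n *_) (divSum-cong m λ c → cong (totient c *_)
    (cong₂ _*_ (cong (_^ (((n ∸ 1) * m) div lcm 2 c)) (sym tcount-e)) (cong (_^ (m div c)) (sym (tcount-pow c))))))
    where
    open TileAction T (fl , pf)
    open TranslationSums {#tiles T} {N′} {M′} h (h-involutive refl)

  private
    transposed-exponent : ∀ x y c → (x * y) div lcm 2 c ≡ (y * x) div lcm c 2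
    transposed-exponent x y c = cong₂ _div_ (*-comm x y) (lcm-comm 2 c)

  FixTor-rotflip-even : (pf : mem R r2f ≡ true) → 2 ∣ m → 2 * FixTor T n m (r2f , pf) ≡
    m * divSum n (λ d → totient d *
      (tcount T (eᴿ R) ^ ((n * m) div lcm d 2) + tcount T (eᴿ R) ^ ((n * (m ∸ 2)) div lcm d 2) * tcount T (powᴿ {R} (r2f , pf) d) ^ ((2 * n) div d)))
  FixTor-rotflip-even pf 2∣m = trans (cong (2 *_) (FixTor-r2f≡Σglide T pf)) (trans (Σglide-even 2∣m) (cong (m *_) (divSum-cong n λ d → cong (totient d *_)
    (cong₂ _+_ (cong₂ _^_ (sym tcount-e) (transposed-exponent m n d))
               (cong₂ _*_ (cong₂ _^_ (sym tcount-e) (transposed-exponent (m ∸ 2) n d)) (cong (_^ ((2 * n) div d)) (sym (tcount-pow d))))))))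
    where
    open TileAction T (r2f , pf)
    open TranslationSums {#tiles T} {M′} {N′} h (h-involutive refl)

  FixTor-rotflip-odd : (pf : mem R r2f ≡ true) → ¬ (2 ∣ m) → FixTor T n m (r2f , pf) ≡
    m * divSum n (λ d → totient d * (tcount T (eᴿ R) ^ ((n * (m ∸ 1)) div lcm d 2) * tcount T (powᴿ {R} (r2f , pf) d) ^ (n div d)))
  FixTor-rotflip-odd pf 2∤m = trans (FixTor-r2f≡Σglide T pf) (trans (Σglide-odd 2∤m) (cong (m *_) (divSum-cong n λ d → cong (totient d *_)
    (cong₂ _*_ (cong₂ _^_ (sym tcount-e) (transposed-exponent (m ∸ 1) n d)) (cong (_^ (n div d)) (sym (tcount-pow d)))))))
    where
    open TileAction T (r2f , pf)
    open TranslationSums {#tiles T} {M′} {N′} h (h-involutive refl)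

mainTheorem12 : (n m : ℕ) → 1 ≤ n → 1 ≤ m → (R : Subgroup) → (T : TileSet R) →
    ((pf : mem R fl ≡ true) →
      (2 ∣ n → 2 * FixTor T n m (fl , pf) ≡
         n * divSum m (λ c → totient c *
           (tcount T (eᴿ R) ^ ((n * m) div lcm 2 c)
            + tcount T (eᴿ R) ^ (((n ∸ 2) * m) div lcm 2 c)
              * tcount T (powᴿ {R} (fl , pf) c) ^ ((2 * m) div c))))
      × (¬ (2 ∣ n) → FixTor T n m (fl , pf) ≡
         n * divSum m (λ c → totient c *
           (tcount T (eᴿ R) ^ (((n ∸ 1) * m) div lcm 2 c)
            * tcount T (powᴿ {R} (fl , pf) c) ^ (m div c)))))
    × ((pf : mem R r2f ≡ true) →
      (2 ∣ m → 2 * FixTor T n m (r2f , pf) ≡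
         m * divSum n (λ d → totient d *
           (tcount T (eᴿ R) ^ ((n * m) div lcm d 2)
            + tcount T (eᴿ R) ^ ((n * (m ∸ 2)) div lcm d 2)
              * tcount T (powᴿ {R} (r2f , pf) d) ^ ((2 * n) div d))))
      × (¬ (2 ∣ m) → FixTor T n m (r2f , pf) ≡
         m * divSum n (λ d → totient d *
           (tcount T (eᴿ R) ^ ((n * (m ∸ 1)) div lcm d 2)
            * tcount T (powᴿ {R} (r2f , pf) d) ^ (n div d)))))
mainTheorem12 (suc N′) (suc M′) _ _ R T =
    (λ pf → FixTor-flip-even T N′ M′ pf , FixTor-flip-odd T N′ M′ pf)
  , (λ pf → FixTor-rotflip-even T N′ M′ pf , FixTor-rotflip-odd T N′ M′ pf)
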